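{- Let $x$ be a positive integer and $n\ge 0$. The number $\kappa_n$ of kernel positions of rank $n$ in the polynomial Bernoulli game of the second kind indexed by $x$ is $$\kappa_n=\sum_{m=0}^{n-1}\binom{x+m-2}{m}m!(m+1)!\sum_{k=0}^{n-m-1}\sum_{m=i_0<i_1<\cdots<i_{k+1}=n}\prod_{j=0}^k (i_{j+1}-i_j-1)!^2\binom{i_{j+1}}{i_j+1}\binom{i_{j+1}+1}{i_j}\;+\;\binom{x+n-2}{n}n!(n+1)!.$$
   Context: The polynomial Bernoulli game of the second kind indexed by $x$: positions of rank $n\ge0$ are triples of words $(u_1\cdots u_n,v_1\cdots v_n,w_1\cdots w_n)$ of positive integers with $1\le u_i\le i$, $1\le v_i\le i+1$, $1\le w_i\le x$ for all $i$, and $w_1\le w_2\le\cdots\le w_n$. A valid move replaces the triple by $(u_1\cdots u_m,v_1\cdots v_m,w_1\cdots w_m)$ for some $0\le m<n$ with $w_{m+1}=\cdots=w_n=x$ and $u_{m+1}<v_j$ for all $j=m+1,\ldots,n$. Players alternate; a player unable to move loses; kernel positions are positions of Grundy number zero (every valid move from them leads to a non-kernel position). Binomial coefficients $\binom{a}{m}$ are $a(a-1)\cdots(a-m+1)/m!$. -}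

module Defs where

open import Data.Nat using (ℕ; zero; suc; _+_; _*_; _∸_; _≡ᵇ_; _<ᵇ_; _≤ᵇ_; _!)
open import Data.Nat.Combinatorics using (_C_)
open import Data.Nat.ListAction using (sum)
open import Data.Bool.ListAction using (all; any)
open import Data.Bool using (Bool; true; false; if_then_else_; _∧_; not)
open import Data.List using (List; []; _∷_; length; map; concatMap; filterᵇ; upTo; take; drop; applyUpTo)
open import Data.Product using (_×_; _,_)

-- Positions: triples of words (u , v , w) of positive integers.
-- Words are lists, letter i (1-indexed in the paper) is list index i-1.

Word : Set
Word = List ℕ

Pos : Set
Pos = Word × Word × Word

rank : Pos → ℕ
rank (u , v , w) = length u

range1 : ℕ → List ℕ
range1 b = applyUpTo suc b

words : ℕ → ℕ → List Word
words zero    b = [] ∷ []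
words (suc n) b = concatMap (λ w → map (λ a → a ∷ w) (range1 b)) (words n b)

boundedFrom : ℕ → ℕ → Word → Bool
boundedFrom c i []       = true
boundedFrom c i (a ∷ as) = (1 ≤ᵇ a) ∧ (a ≤ᵇ (i + c)) ∧ boundedFrom c (suc i) as

nondecreasing : Word → Bool
nondecreasing []           = true
nondecreasing (a ∷ [])     = true
nondecreasing (a ∷ b ∷ bs) = (a ≤ᵇ b) ∧ nondecreasing (b ∷ bs)

validPos : ℕ → ℕ → Pos → Bool
validPos x n (u , v , w) =
  (length u ≡ᵇ n) ∧ (length v ≡ᵇ n) ∧ (length w ≡ᵇ n)
  ∧ boundedFrom 0 1 u ∧ boundedFrom 1 1 v
  ∧ all (λ a → (1 ≤ᵇ a) ∧ (a ≤ᵇ x)) w ∧ nondecreasing w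

positions : ℕ → ℕ → List Pos
positions x n =
  filterᵇ (validPos x n)
    (concatMap (λ u → concatMap (λ v → map (λ w → (u , v , w))
        (words n x)) (words n (suc n))) (words n n))

-- the move to the prefix of length m is valid from p:
-- m < n, w_{m+1} = … = w_n = x, and u_{m+1} < v_j for j = m+1..n
validMove : ℕ → Pos → ℕ → Bool
validMove x (u , v , w) m with drop m u
... | []      = false
... | um1 ∷ _ = (m <ᵇ length u)
               ∧ all (λ a → a ≡ᵇ x) (drop m w)
               ∧ all (λ b → um1 <ᵇ b) (drop m v)

truncate : ℕ → Pos → Pos
truncate m (u , v , w) = (take m u , take m v , take m w)

options : ℕ → Pos → List Pos
options x p = map (λ m → truncate m p) (filterᵇ (validMove x p) (upTo (rank p)))

mexFrom : ℕ → ℕ → List ℕ → ℕ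
mexFrom zero    k l = k
mexFrom (suc f) k l = if any (λ y → y ≡ᵇ k) l then mexFrom f (suc k) l else k

mex : List ℕ → ℕ
mex l = mexFrom (length l) 0 l

-- Grundy number, by recursion with fuel; fuel ≥ rank suffices since
-- every move strictly decreases the rank.
grundyF : ℕ → ℕ → Pos → ℕ
grundyF x zero    p = mex []
grundyF x (suc f) p = mex (map (grundyF x f) (options x p))

grundy : ℕ → Pos → ℕ
grundy x p = grundyF x (suc (rank p)) p

isKernel : ℕ → Pos → Bool
isKernel x p = grundy x p ≡ᵇ 0

kernelCount : ℕ → ℕ → ℕ
kernelCount x n = length (filterᵇ (isKernel x) (positions x n))

sumBelow : ℕ → (ℕ → ℕ) → ℕ
sumBelow n f = sum (map f (upTo n))

-- factor for one step a = i_j < b = i_{j+1}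
stepF : ℕ → ℕ → ℕ
stepF a b = ((b ∸ a ∸ 1) !) * ((b ∸ a ∸ 1) !) * (b C (a + 1)) * ((b + 1) C a)

-- chains k a n = Σ over a = i_0 < i_1 < … < i_{k+1} = n of Π_{j=0}^{k} stepF i_j i_{j+1}
chains : ℕ → ℕ → ℕ → ℕ
chains zero    a n = if a <ᵇ n then stepF a n else 0
chains (suc k) a n = sumBelow n (λ b → if a <ᵇ b then stepF a b * chains k b n else 0)

-- binom(x + m - 2, m) in the falling-factorial sense, for x ≥ 1.
-- (With truncated subtraction this agrees with the generalized binomial:
--  for x = 1, m = 0 it is 1 = binom(-1,0); for x = 1, m ≥ 1 it is
--  binom(m-1, m) = 0.)
binomX : ℕ → ℕ → ℕ
binomX x m = (x + m ∸ 2) C m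

kappaFormula : ℕ → ℕ → ℕ
kappaFormula x n =
  sumBelow n (λ m → binomX x m * (m !) * (suc m !)
                    * sumBelow (n ∸ m) (λ k → chains k m n))
  + binomX x n * (n !) * (suc n !)

module Submission where

open import Defs
open import Data.Nat using (ℕ; _≤_)
open import Relation.Binary.PropositionalEquality using (_≡_)

open import Data.Nat
open import Data.Nat.Properties
open import Data.Nat.Combinatorics
  using (_C_; nCk≡n!/k![n-k]!; k>n⇒nCk≡0; k![n∸k]!∣n!; nCk+nC[k+1]≡[n+1]C[k+1])
open import Data.Nat.DivMod using (m/n*n≡m)
open import Data.Nat.Tactic.RingSolver using (solve-∀)
open import Data.Nat.ListAction using (sum)
open import Data.Bool using (Bool; true; false; if_then_else_; _∧_; _∨_; not)
open import Data.Bool.Properties using (T-≡)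
open import Data.Bool.ListAction using (all; any; or)
open import Data.List
  using (List; []; _∷_; map; concatMap; filterᵇ; applyUpTo; upTo; length; take; drop; _++_)
open import Data.List.Properties using (length-take; take-take; take-all; drop-drop; map-∘; map-cong-local)
open import Data.Product using (_×_; _,_; proj₁; proj₂)
open import Data.Sum using (inj₁; inj₂)
open import Data.List.Relation.Unary.All using (All)
import Data.List.Relation.Unary.All as All
import Data.List.Relation.Unary.All.Properties as All
open import Relation.Nullary.Decidable using (T?)
open import Function using (_∘_)
open import Data.Empty using (⊥; ⊥-elim)
open import Function.Bundles using (Equivalence)
open import Relation.Binary.Definitions using (tri<; tri≈; tri>)
open import Relation.Binary.PropositionalEquality
open import Algebra.Properties.CommutativeSemigroup +-commutativeSemigroup using (interchange)
open ≡-Reasoning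

-- A position is a triple (u , v , w) of words, so κ_n is a triple sum over words.
-- 1. In any game a position is a kernel position iff none of its options is.
-- 2. Let m be the stem of w: w without its final run of letters x.  Every move
--    goes to a prefix of length ≥ m, so the prefix of length m is a kernel
--    position, and the kernel prefixes beyond it form a chain found greedily
--    from the letters of u and v.  Whether the whole position is a kernel
--    position is thus a Boolean function `relKernel` of the letters of u and v
--    after position m, independent of w.
-- 3. The number G a d of continuations of length d after a kernel prefix of
--    length a that end in a kernel position satisfies
--    G a (d+1) = Σ_i stepF a (a+1+i) · G (a+1+i) (d-i), the step factor being
--    computed by hockey-stick identities; so G is the chain sum of the formula.
-- 4. The first m letters of u and v are free (m! (m+1)! choices), and the
--    nondecreasing words over 1 … x of length n with stem m number binom(x+m-2, m).
-- Summing over the stem m then gives the formula.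

ind : Bool → ℕ
ind true  = 1
ind false = 0

ind-∧ : ∀ a b → ind (a ∧ b) ≡ ind a * ind b
ind-∧ true  b = sym (+-identityʳ (ind b))
ind-∧ false b = refl

ind-if : ∀ c a b → ind (if c then a else b) ≡ (if c then ind a else ind b)
ind-if true  a b = refl
ind-if false a b = refl

ΣL : {A : Set} → List A → (A → ℕ) → ℕ
ΣL []      f = 0
ΣL (a ∷ l) f = f a + ΣL l f

ΣL-cong : {A : Set} (l : List A) {f g : A → ℕ} → (∀ a → f a ≡ g a) → ΣL l f ≡ ΣL l g
ΣL-cong []      e = refl
ΣL-cong (a ∷ l) e = cong₂ _+_ (e a) (ΣL-cong l e)

ΣL-++ : {A : Set} (l₁ l₂ : List A) (f : A → ℕ) → ΣL (l₁ ++ l₂) f ≡ ΣL l₁ f + ΣL l₂ f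
ΣL-++ []       l₂ f = refl
ΣL-++ (a ∷ l₁) l₂ f = trans (cong (f a +_) (ΣL-++ l₁ l₂ f)) (sym (+-assoc (f a) _ _))

ΣL-map : {A B : Set} (g : A → B) (l : List A) (f : B → ℕ) → ΣL (map g l) f ≡ ΣL l (λ a → f (g a))
ΣL-map g []      f = refl
ΣL-map g (a ∷ l) f = cong (f (g a) +_) (ΣL-map g l f)

ΣL-concatMap : {A B : Set} (g : A → List B) (l : List A) (f : B → ℕ) →
               ΣL (concatMap g l) f ≡ ΣL l (λ a → ΣL (g a) f)
ΣL-concatMap g []      f = refl
ΣL-concatMap g (a ∷ l) f =
  trans (ΣL-++ (g a) (concatMap g l) f) (cong (ΣL (g a) f +_) (ΣL-concatMap g l f))

ΣL-filter : {A : Set} (p : A → Bool) (l : List A) (f : A → ℕ) →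
            ΣL (filterᵇ p l) f ≡ ΣL l (λ a → ind (p a) * f a)
ΣL-filter p []      f = refl
ΣL-filter p (a ∷ l) f with p a
... | true  = cong₂ _+_ (sym (+-identityʳ (f a))) (ΣL-filter p l f)
... | false = ΣL-filter p l f

length-filter : {A : Set} (p : A → Bool) (l : List A) → length (filterᵇ p l) ≡ ΣL l (λ a → ind (p a))
length-filter p []      = refl
length-filter p (a ∷ l) with p a
... | true  = cong suc (length-filter p l)
... | false = length-filter p l

sum-map : {A : Set} (f : A → ℕ) (l : List A) → sum (map f l) ≡ ΣL l f
sum-map f []      = refl
sum-map f (a ∷ l) = cong (f a +_) (sum-map f l)

Σ< : ℕ → (ℕ → ℕ) → ℕ
Σ< zero    f = 0
Σ< (suc n) f = f 0 + Σ< n (λ i → f (suc i))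

ΣL-applyUpTo : (g : ℕ → ℕ) (n : ℕ) (f : ℕ → ℕ) → ΣL (applyUpTo g n) f ≡ Σ< n (λ i → f (g i))
ΣL-applyUpTo g zero    f = refl
ΣL-applyUpTo g (suc n) f = cong (f (g 0) +_) (ΣL-applyUpTo (λ i → g (suc i)) n f)

sumBelow≡Σ< : ∀ n f → sumBelow n f ≡ Σ< n f
sumBelow≡Σ< n f = trans (sum-map f (upTo n)) (ΣL-applyUpTo (λ i → i) n f)

Σ<-cong : ∀ n {f g : ℕ → ℕ} → (∀ i → i < n → f i ≡ g i) → Σ< n f ≡ Σ< n g
Σ<-cong zero    e = refl
Σ<-cong (suc n) e = cong₂ _+_ (e 0 z<s) (Σ<-cong n (λ i i<n → e (suc i) (s<s i<n)))

Σ<-ext : ∀ n {f g : ℕ → ℕ} → (∀ i → f i ≡ g i) → Σ< n f ≡ Σ< n g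
Σ<-ext n e = Σ<-cong n (λ i _ → e i)

Σ<-0 : ∀ n → Σ< n (λ _ → 0) ≡ 0
Σ<-0 zero    = refl
Σ<-0 (suc n) = Σ<-0 n

Σ<-const : ∀ n k → Σ< n (λ _ → k) ≡ n * k
Σ<-const zero    k = refl
Σ<-const (suc n) k = cong (k +_) (Σ<-const n k)

Σ<-+ : ∀ n (f g : ℕ → ℕ) → Σ< n (λ i → f i + g i) ≡ Σ< n f + Σ< n g
Σ<-+ zero    f g = refl
Σ<-+ (suc n) f g = trans (cong (f 0 + g 0 +_) (Σ<-+ n (λ i → f (suc i)) (λ i → g (suc i))))
                         (interchange (f 0) (g 0) _ _)

Σ<-*ˡ : ∀ n k (f : ℕ → ℕ) → Σ< n (λ i → k * f i) ≡ k * Σ< n f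
Σ<-*ˡ zero    k f = sym (*-zeroʳ k)
Σ<-*ˡ (suc n) k f =
  trans (cong (k * f 0 +_) (Σ<-*ˡ n k (λ i → f (suc i)))) (sym (*-distribˡ-+ k (f 0) _))

Σ<-*ʳ : ∀ n k (f : ℕ → ℕ) → Σ< n (λ i → f i * k) ≡ Σ< n f * k
Σ<-*ʳ n k f = trans (Σ<-ext n (λ i → *-comm (f i) k)) (trans (Σ<-*ˡ n k f) (*-comm k _))

Σ<-swap : ∀ n m (f : ℕ → ℕ → ℕ) → Σ< n (λ i → Σ< m (f i)) ≡ Σ< m (λ j → Σ< n (λ i → f i j))
Σ<-swap zero    m f = sym (Σ<-0 m)
Σ<-swap (suc n) m f =
  trans (cong (Σ< m (f 0) +_) (Σ<-swap n m (λ i → f (suc i)))) (sym (Σ<-+ m (f 0) _))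

ΣL-Σ< : {A : Set} (l : List A) (n : ℕ) (f : A → ℕ → ℕ) →
        ΣL l (λ a → Σ< n (f a)) ≡ Σ< n (λ i → ΣL l (λ a → f a i))
ΣL-Σ< []      n f = sym (Σ<-0 n)
ΣL-Σ< (a ∷ l) n f = trans (cong (Σ< n (f a) +_) (ΣL-Σ< l n f)) (sym (Σ<-+ n (f a) _))

Σ<-last : ∀ n (f : ℕ → ℕ) → Σ< (suc n) f ≡ Σ< n f + f n
Σ<-last zero    f = +-comm (f 0) 0
Σ<-last (suc n) f = trans (cong (f 0 +_) (Σ<-last n (λ i → f (suc i)))) (sym (+-assoc (f 0) _ _))

Σ<-split : ∀ n m (f : ℕ → ℕ) → Σ< (n + m) f ≡ Σ< n f + Σ< m (λ i → f (n + i))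
Σ<-split zero    m f = refl
Σ<-split (suc n) m f =
  trans (cong (f 0 +_) (Σ<-split n m (λ i → f (suc i)))) (sym (+-assoc (f 0) _ _))

Σ<-vanish : ∀ n m (f : ℕ → ℕ) → (∀ i → n ≤ i → f i ≡ 0) → Σ< (n + m) f ≡ Σ< n f
Σ<-vanish n m f z = trans (Σ<-split n m f)
  (trans (cong (Σ< n f +_) (trans (Σ<-ext m (λ i → z (n + i) (m≤m+n n i))) (Σ<-0 m)))
         (+-identityʳ _))

Σ<-delta : ∀ n k (f : ℕ → ℕ) → k < n → Σ< n (λ i → ind (i ≡ᵇ k) * f i) ≡ f k
Σ<-delta (suc n) zero    f _         = trans (cong₂ _+_ (*-identityˡ (f 0)) (Σ<-0 n)) (+-identityʳ _)
Σ<-delta (suc n) (suc k) f (s≤s k<n) = Σ<-delta n k (λ i → f (suc i)) k<n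

-- Sums over words.  ΣW bnd s n F sums F over the words of length n whose
-- letter in position s + k (k = 0, 1, …) ranges over 1 … bnd (s + k); the
-- three words of a position are summed this way with bounds n, n+1, x
-- (from the enumeration) or i, i+1 (the rules of the game).
ΣW : (ℕ → ℕ) → ℕ → ℕ → (List ℕ → ℕ) → ℕ
ΣW bnd s zero    F = F []
ΣW bnd s (suc n) F = Σ< (bnd s) (λ a → ΣW bnd (suc s) n (λ w → F (suc a ∷ w)))

data Fits (bnd : ℕ → ℕ) : ℕ → ℕ → List ℕ → Set where
  []  : ∀ {s} → Fits bnd s zero []
  _∷_ : ∀ {s n a w} → a < bnd s → Fits bnd (suc s) n w → Fits bnd s (suc n) (suc a ∷ w)

Fits-length : ∀ {bnd s n w} → Fits bnd s n w → length w ≡ n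
Fits-length []       = refl
Fits-length (_ ∷ fw) = cong suc (Fits-length fw)

ΣW-cong : ∀ bnd s n {F G : List ℕ → ℕ} → (∀ w → Fits bnd s n w → F w ≡ G w) →
          ΣW bnd s n F ≡ ΣW bnd s n G
ΣW-cong bnd s zero    e = e [] []
ΣW-cong bnd s (suc n) e =
  Σ<-cong (bnd s) (λ a a< → ΣW-cong bnd (suc s) n (λ w fw → e (suc a ∷ w) (a< ∷ fw)))

ΣW-ext : ∀ bnd s n {F G : List ℕ → ℕ} → (∀ w → F w ≡ G w) → ΣW bnd s n F ≡ ΣW bnd s n G
ΣW-ext bnd s n e = ΣW-cong bnd s n (λ w _ → e w)

ΣW-bound-ext : ∀ {b₁ b₂} → (∀ i → b₁ i ≡ b₂ i) → ∀ s n F → ΣW b₁ s n F ≡ ΣW b₂ s n F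
ΣW-bound-ext e s zero    F = refl
ΣW-bound-ext {b₁} {b₂} e s (suc n) F =
  trans (cong (λ k → Σ< k (λ a → ΣW b₁ (suc s) n (λ w → F (suc a ∷ w)))) (e s))
        (Σ<-ext (b₂ s) (λ a → ΣW-bound-ext e (suc s) n _))

ΣW-const-start : ∀ b s s' n F → ΣW (λ _ → b) s n F ≡ ΣW (λ _ → b) s' n F
ΣW-const-start b s s' zero    F = refl
ΣW-const-start b s s' (suc n) F = Σ<-ext b (λ a → ΣW-const-start b (suc s) (suc s') n _)

ΣW-+ : ∀ bnd s n (F G : List ℕ → ℕ) → ΣW bnd s n (λ w → F w + G w) ≡ ΣW bnd s n F + ΣW bnd s n G
ΣW-+ bnd s zero    F G = refl
ΣW-+ bnd s (suc n) F G = trans (Σ<-ext (bnd s) (λ a → ΣW-+ bnd (suc s) n _ _)) (Σ<-+ (bnd s) _ _)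

ΣW-*ˡ : ∀ bnd s n k (F : List ℕ → ℕ) → ΣW bnd s n (λ w → k * F w) ≡ k * ΣW bnd s n F
ΣW-*ˡ bnd s zero    k F = refl
ΣW-*ˡ bnd s (suc n) k F = trans (Σ<-ext (bnd s) (λ a → ΣW-*ˡ bnd (suc s) n k _)) (Σ<-*ˡ (bnd s) k _)

ΣW-const : ∀ bnd s n k → ΣW bnd s n (λ _ → k) ≡ k * ΣW bnd s n (λ _ → 1)
ΣW-const bnd s n k = trans (ΣW-ext bnd s n (λ _ → sym (*-identityʳ k))) (ΣW-*ˡ bnd s n k (λ _ → 1))

ΣW-if : ∀ bnd s n c (F G : List ℕ → ℕ) →
        ΣW bnd s n (λ w → if c then F w else G w) ≡ (if c then ΣW bnd s n F else ΣW bnd s n G)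
ΣW-if bnd s n true  F G = refl
ΣW-if bnd s n false F G = refl

ΣW-Σ< : ∀ bnd s n m (F : ℕ → List ℕ → ℕ) →
        ΣW bnd s n (λ w → Σ< m (λ i → F i w)) ≡ Σ< m (λ i → ΣW bnd s n (F i))
ΣW-Σ< bnd s zero    m F = refl
ΣW-Σ< bnd s (suc n) m F =
  trans (Σ<-ext (bnd s) (λ a → ΣW-Σ< bnd (suc s) n m _)) (Σ<-swap (bnd s) m _)

ΣW-swap : ∀ b₁ s₁ n₁ b₂ s₂ n₂ (F : List ℕ → List ℕ → ℕ) →
          ΣW b₁ s₁ n₁ (λ w → ΣW b₂ s₂ n₂ (F w)) ≡ ΣW b₂ s₂ n₂ (λ w' → ΣW b₁ s₁ n₁ (λ w → F w w'))
ΣW-swap b₁ s₁ zero     b₂ s₂ n₂ F = refl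
ΣW-swap b₁ s₁ (suc n₁) b₂ s₂ n₂ F =
  trans (Σ<-ext (b₁ s₁) (λ a → ΣW-swap b₁ (suc s₁) n₁ b₂ s₂ n₂ (λ w → F (suc a ∷ w))))
        (sym (ΣW-Σ< b₂ s₂ n₂ (b₁ s₁) (λ a w' → ΣW b₁ (suc s₁) n₁ (λ w → F (suc a ∷ w) w'))))

ΣW-split : ∀ bnd s n m (F : List ℕ → ℕ) →
           ΣW bnd s (n + m) F ≡ ΣW bnd s n (λ p → ΣW bnd (s + n) m (λ q → F (p ++ q)))
ΣW-split bnd s zero    m F = cong (λ s' → ΣW bnd s' m F) (sym (+-identityʳ s))
ΣW-split bnd s (suc n) m F = Σ<-ext (bnd s) (λ a → trans (ΣW-split bnd (suc s) n m _)
  (ΣW-ext bnd (suc s) n (λ p → cong (λ s' → ΣW bnd s' m (λ q → F (suc a ∷ p ++ q))) (sym (+-suc s n)))))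

ΣL-words : ∀ n b s (F : List ℕ → ℕ) → ΣL (words n b) F ≡ ΣW (λ _ → b) s n F
ΣL-words zero    b s F = +-identityʳ (F [])
ΣL-words (suc n) b s F = begin
  ΣL (concatMap (λ w → map (λ a → a ∷ w) (range1 b)) (words n b)) F
    ≡⟨ ΣL-concatMap _ (words n b) F ⟩
  ΣL (words n b) (λ w → ΣL (map (λ a → a ∷ w) (range1 b)) F)
    ≡⟨ ΣL-cong (words n b) (λ w → trans (ΣL-map _ (range1 b) F) (ΣL-applyUpTo suc b (λ a → F (a ∷ w)))) ⟩
  ΣL (words n b) (λ w → Σ< b (λ a → F (suc a ∷ w)))
    ≡⟨ ΣL-Σ< (words n b) b (λ w a → F (suc a ∷ w)) ⟩
  Σ< b (λ a → ΣL (words n b) (λ w → F (suc a ∷ w)))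
    ≡⟨ Σ<-ext b (λ a → ΣL-words n b (suc s) _) ⟩
  ΣW (λ _ → b) s (suc n) F ∎

≡ᵇ-sound : ∀ m n → (m ≡ᵇ n) ≡ true → m ≡ n
≡ᵇ-sound m n e = ≡ᵇ⇒≡ m n (Equivalence.from T-≡ e)

≡ᵇ-complete : ∀ m n → m ≡ n → (m ≡ᵇ n) ≡ true
≡ᵇ-complete m n e = Equivalence.to T-≡ (≡⇒≡ᵇ m n e)

<⇒≡ᵇ-false : ∀ m n → m < n → (m ≡ᵇ n) ≡ false
<⇒≡ᵇ-false zero    (suc n) _         = refl
<⇒≡ᵇ-false (suc m) (suc n) (s≤s m<n) = <⇒≡ᵇ-false m n m<n

<ᵇ-sound : ∀ m n → (m <ᵇ n) ≡ true → m < n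
<ᵇ-sound m n e = <ᵇ⇒< m n (Equivalence.from T-≡ e)

<ᵇ-complete : ∀ m n → m < n → (m <ᵇ n) ≡ true
<ᵇ-complete m n m<n = Equivalence.to T-≡ (<⇒<ᵇ m<n)

≤ᵇ-sound : ∀ m n → (m ≤ᵇ n) ≡ true → m ≤ n
≤ᵇ-sound m n e = ≤ᵇ⇒≤ m n (Equivalence.from T-≡ e)

<ᵇ-false-sound : ∀ m n → (m <ᵇ n) ≡ false → n ≤ m
<ᵇ-false-sound m       zero    _ = z≤n
<ᵇ-false-sound (suc m) (suc n) e = s≤s (<ᵇ-false-sound m n e)

<ᵇ-false-complete : ∀ m n → n ≤ m → (m <ᵇ n) ≡ false
<ᵇ-false-complete m       zero    _         = refl
<ᵇ-false-complete (suc m) (suc n) (s≤s n≤m) = <ᵇ-false-complete m n n≤m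

∧-true⁻ : ∀ a b → (a ∧ b) ≡ true → (a ≡ true) × (b ≡ true)
∧-true⁻ true true _ = refl , refl

∧-true⁺ : ∀ {a b} → a ≡ true → b ≡ true → (a ∧ b) ≡ true
∧-true⁺ refl refl = refl

true≢false : ∀ {b} → b ≡ true → b ≡ false → ⊥
true≢false refl ()

¬true⇒false : ∀ b → (b ≡ true → ⊥) → b ≡ false
¬true⇒false true  h = ⊥-elim (h refl)
¬true⇒false false h = refl

any-map : {A B : Set} (p : B → Bool) (h : A → B) (l : List A) → any p (map h l) ≡ any (λ a → p (h a)) l
any-map p h l = cong or (sym (map-∘ l))

any-filter : {A : Set} (p q : A → Bool) (l : List A) → any p (filterᵇ q l) ≡ any (λ a → q a ∧ p a) l
any-filter p q []      = refl
any-filter p q (a ∷ l) with q a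
... | true  = cong (p a ∨_) (any-filter p q l)
... | false = any-filter p q l

any-applyUpTo-false⁻ : (p : ℕ → Bool) (g : ℕ → ℕ) (r : ℕ) → any p (applyUpTo g r) ≡ false →
                       ∀ c → c < r → p (g c) ≡ false
any-applyUpTo-false⁻ p g (suc r) e c c<r with p (g 0) in eq
any-applyUpTo-false⁻ p g (suc r) e zero    _         | false = eq
any-applyUpTo-false⁻ p g (suc r) e (suc c) (s≤s c<r) | false =
  any-applyUpTo-false⁻ p (λ i → g (suc i)) r e c c<r

any-applyUpTo-false⁺ : (p : ℕ → Bool) (g : ℕ → ℕ) (r : ℕ) → (∀ c → c < r → p (g c) ≡ false) →
                       any p (applyUpTo g r) ≡ false
any-applyUpTo-false⁺ p g zero    h = refl
any-applyUpTo-false⁺ p g (suc r) h rewrite h 0 z<s =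
  any-applyUpTo-false⁺ p (λ i → g (suc i)) r (λ c c<r → h (suc c) (s<s c<r))

-- Kernel positions in general: a position is a kernel position iff none of
-- its options is.  The fuel of grundyF is irrelevant once it exceeds the rank,
-- because every option has smaller rank.
rank-truncate : ∀ c (p : Pos) → rank (truncate c p) ≤ c
rank-truncate c (u , v , w) = subst (_≤ c) (sym (length-take c u)) (m⊓n≤m c (length u))

options-smaller : ∀ x q → All (λ p → rank p < rank q) (options x q)
options-smaller x q = All.map⁺ (All.filter⁺ (T? ∘ validMove x q)
  (All.applyUpTo⁺₁ (λ c → c) (rank q) (λ {c} c<r → ≤-<-trans (rank-truncate c q) c<r)))

grundyF-fuel : ∀ x f f' (q : Pos) → rank q < f → rank q < f' → grundyF x f q ≡ grundyF x f' q
grundyF-fuel x (suc f) (suc f') q (s≤s r≤f) (s≤s r≤f') = cong mex (map-cong-local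
  (All.map (λ {p} p<q → grundyF-fuel x f f' p (<-≤-trans p<q r≤f) (<-≤-trans p<q r≤f'))
           (options-smaller x q)))

mexFrom-suc : ∀ f k l → (mexFrom f (suc k) l ≡ᵇ 0) ≡ false
mexFrom-suc zero    k l = refl
mexFrom-suc (suc f) k l with any (λ y → y ≡ᵇ suc k) l
... | true  = mexFrom-suc f (suc k) l
... | false = refl

mex-zero : ∀ l → (mex l ≡ᵇ 0) ≡ not (any (λ y → y ≡ᵇ 0) l)
mex-zero []      = refl
mex-zero (y ∷ l) with any (λ y → y ≡ᵇ 0) (y ∷ l)
... | true  = mexFrom-suc (length l) 0 (y ∷ l)
... | false = refl

kernel-options : ∀ x q → isKernel x q ≡ not (any (isKernel x) (options x q))
kernel-options x q = begin
  (mex (map G (options x q)) ≡ᵇ 0)              ≡⟨ mex-zero (map G (options x q)) ⟩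
  not (any (λ y → y ≡ᵇ 0) (map G (options x q))) ≡⟨ cong not (any-map _ G (options x q)) ⟩
  not (any (λ p → G p ≡ᵇ 0) (options x q))      ≡⟨ cong (λ l → not (or l)) (map-cong-local
    (All.map (λ {p} p<q → cong (_≡ᵇ 0) (grundyF-fuel x _ _ p p<q ≤-refl)) (options-smaller x q))) ⟩
  not (any (isKernel x) (options x q))          ∎
  where
  G : Pos → ℕ
  G = grundyF x (rank q)

kernel-moves : ∀ x q → isKernel x q ≡
  not (any (λ c → validMove x q c ∧ isKernel x (truncate c q)) (upTo (rank q)))
kernel-moves x q = trans (kernel-options x q) (cong not
  (trans (any-map (isKernel x) (λ c → truncate c q) (filterᵇ (validMove x q) (upTo (rank q))))
         (any-filter _ (validMove x q) (upTo (rank q)))))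

kernel-elim : ∀ x q → isKernel x q ≡ true → ∀ c → c < rank q → validMove x q c ≡ true →
              isKernel x (truncate c q) ≡ false
kernel-elim x q k c c<r vm with any-applyUpTo-false⁻ _ (λ i → i) (rank q)
  (¬true⇒false _ (λ a → true≢false k (trans (kernel-moves x q) (cong not a)))) c c<r
... | e rewrite vm = e

kernel-intro : ∀ x q → (∀ c → c < rank q → validMove x q c ≡ true → isKernel x (truncate c q) ≡ false) →
               isKernel x q ≡ true
kernel-intro x q h = trans (kernel-moves x q) (cong not (any-applyUpTo-false⁺ _ (λ i → i) (rank q) step))
  where
  step : ∀ c → c < rank q → (validMove x q c ∧ isKernel x (truncate c q)) ≡ false
  step c c<r with validMove x q c in vm
  ... | true  = h c c<r vm
  ... | false = refl

-- Letters of words.  `at l i` is the letter of l in (0-based) position i.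
at : List ℕ → ℕ → ℕ
at []      _       = 0
at (a ∷ l) zero    = a
at (a ∷ l) (suc i) = at l i

drop-at : ∀ c (l : List ℕ) → c < length l → drop c l ≡ at l c ∷ drop (suc c) l
drop-at zero    (a ∷ l) _        = refl
drop-at (suc c) (a ∷ l) (s≤s c<) = drop-at c l c<

at-take : ∀ b j (l : List ℕ) → j < b → at (take b l) j ≡ at l j
at-take (suc b) j       []      _         = refl
at-take (suc b) zero    (a ∷ l) _         = refl
at-take (suc b) (suc j) (a ∷ l) (s≤s j<b) = at-take b j l j<b

drop-take-self : ∀ b (l : List ℕ) → drop b (take b l) ≡ []
drop-take-self zero    []      = refl
drop-take-self zero    (a ∷ l) = refl
drop-take-self (suc b) []      = refl
drop-take-self (suc b) (a ∷ l) = drop-take-self b l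

drop-++ : ∀ (p q : List ℕ) → drop (length p) (p ++ q) ≡ q
drop-++ []      q = refl
drop-++ (a ∷ p) q = drop-++ p q

all-drop⁻ : (p : ℕ → Bool) → ∀ c l → all p (drop c l) ≡ true →
            ∀ j → c ≤ j → j < length l → p (at l j) ≡ true
all-drop⁻ p zero    (a ∷ l) e zero    _         _        = proj₁ (∧-true⁻ (p a) _ e)
all-drop⁻ p zero    (a ∷ l) e (suc j) _         (s≤s j<) = all-drop⁻ p zero l (proj₂ (∧-true⁻ (p a) _ e)) j z≤n j<
all-drop⁻ p (suc c) (a ∷ l) e (suc j) (s≤s c≤j) (s≤s j<) = all-drop⁻ p c l e j c≤j j<

all-drop⁺ : (p : ℕ → Bool) → ∀ c l → (∀ j → c ≤ j → j < length l → p (at l j) ≡ true) →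
            all p (drop c l) ≡ true
all-drop⁺ p zero    []      h = refl
all-drop⁺ p zero    (a ∷ l) h = ∧-true⁺ (h 0 z≤n z<s) (all-drop⁺ p zero l (λ j _ j< → h (suc j) z≤n (s<s j<)))
all-drop⁺ p (suc c) []      h = refl
all-drop⁺ p (suc c) (a ∷ l) h = all-drop⁺ p c l (λ j c≤j j< → h (suc j) (s≤s c≤j) (s<s j<))

-- The stem of w: the length of w once its maximal final run of letters x is
-- removed.  A move to the prefix of length c requires exactly stem x w ≤ c.
allEq : ℕ → List ℕ → Bool
allEq x l = all (λ a → a ≡ᵇ x) l

stem : ℕ → List ℕ → ℕ
stem x []      = 0
stem x (a ∷ w) = if allEq x (a ∷ w) then 0 else suc (stem x w)

stem-length : ∀ x w → stem x w ≤ length w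
stem-length x []      = z≤n
stem-length x (a ∷ w) with allEq x (a ∷ w)
... | true  = z≤n
... | false = s≤s (stem-length x w)

allEq-drop : ∀ x c (l : List ℕ) → allEq x l ≡ true → allEq x (drop c l) ≡ true
allEq-drop x zero    l       e = e
allEq-drop x (suc c) []      e = refl
allEq-drop x (suc c) (a ∷ l) e = allEq-drop x c l (proj₂ (∧-true⁻ (a ≡ᵇ x) _ e))

stem≤⇒allEq : ∀ x c w → stem x w ≤ c → allEq x (drop c w) ≡ true
stem≤⇒allEq x zero    []      _ = refl
stem≤⇒allEq x (suc c) []      _ = refl
stem≤⇒allEq x c       (a ∷ w) h with allEq x (a ∷ w) in eq
... | true = allEq-drop x c (a ∷ w) eq
stem≤⇒allEq x (suc c) (a ∷ w) (s≤s h) | false = stem≤⇒allEq x c w h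

allEq⇒stem≤ : ∀ x c w → allEq x (drop c w) ≡ true → stem x w ≤ c
allEq⇒stem≤ x c       []      _ = z≤n
allEq⇒stem≤ x c       (a ∷ w) h with allEq x (a ∷ w) in eq
... | true = z≤n
allEq⇒stem≤ x zero    (a ∷ w) h | false = ⊥-elim (true≢false h eq)
allEq⇒stem≤ x (suc c) (a ∷ w) h | false = s≤s (allEq⇒stem≤ x c w h)

-- Suppose the prefix of length a of a position is a
-- kernel position and us, vs are the letters of u and v after it.  The kernel
-- prefixes beyond a form a chain: the next one is j + 1 for the first j ≥ a
-- with v_{j+1} ≤ u_{a+1}.  `relKernel us vs` follows this chain and reports
-- whether it ends exactly at the full position; `scan t us vs` looks for the
-- first letter of vs that is ≤ t = u_{a+1}, dropping a letter of us per step.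
mutual
  relKernel : List ℕ → List ℕ → Bool
  relKernel []       vs = true
  relKernel (t ∷ us) vs = scan t us vs

  scan : ℕ → List ℕ → List ℕ → Bool
  scan t us []       = false
  scan t us (b ∷ vs) = if t <ᵇ b then scan t (drop 1 us) vs else relKernel us vs

validMove-unfold : ∀ x U V W c t r → drop c U ≡ t ∷ r →
  validMove x (U , V , W) c ≡ ((c <ᵇ length U) ∧ allEq x (drop c W) ∧ all (λ b → t <ᵇ b) (drop c V))
validMove-unfold x U V W c t r e with drop c U | e
... | .(t ∷ r) | refl = refl

-- Kernel status of the prefixes of one position (u , v , w) of rank n whose
-- word w is x-closed (a letter x is only followed by letters x), as is every
-- nondecreasing word over 1 … x.
module KernelPrefixes (x n : ℕ) (u v w : List ℕ)
  (lu : length u ≡ n) (lv : length v ≡ n) (lw : length w ≡ n)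
  (x-closed : ∀ c j → c ≤ j → j < n → at w c ≡ x → at w j ≡ x) where

  prefix : ℕ → Pos
  prefix b = (take b u , take b v , take b w)

  K : ℕ → Bool
  K b = isKernel x (prefix b)

  m : ℕ
  m = stem x w

  m≤n : m ≤ n
  m≤n = subst (m ≤_) lw (stem-length x w)

  length-take≤ : ∀ {b} (l : List ℕ) → length l ≡ n → b ≤ n → length (take b l) ≡ b
  length-take≤ {b} l e b≤n = trans (length-take b l) (m≤n⇒m⊓n≡m (subst (b ≤_) (sym e) b≤n))

  truncate-prefix : ∀ c b → c ≤ b → truncate c (prefix b) ≡ prefix c
  truncate-prefix c b c≤b rewrite take-take c b u | take-take c b v | take-take c b w | m≤n⇒m⊓n≡m c≤b = refl

  drop-prefix-u : ∀ c b → c < b → b ≤ n → drop c (take b u) ≡ at u c ∷ drop (suc c) (take b u)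
  drop-prefix-u c b c<b b≤n =
    trans (drop-at c (take b u) (subst (c <_) (sym (length-take≤ u lu b≤n)) c<b))
          (cong (_∷ drop (suc c) (take b u)) (at-take b c u c<b))

  Move : ℕ → ℕ → Set
  Move c b = m ≤ c × (∀ j → c ≤ j → j < b → at u c < at v j)

  w-condition⁻ : ∀ c b → c < b → b ≤ n → allEq x (drop c (take b w)) ≡ true → m ≤ c
  w-condition⁻ c b c<b b≤n e = allEq⇒stem≤ x c w (all-drop⁺ _ c w λ j c≤j j<lw →
    ≡ᵇ-complete _ _ (x-closed c j c≤j (subst (j <_) lw j<lw) (trans (sym (at-take b c w c<b))
      (≡ᵇ-sound _ _ (all-drop⁻ _ c (take b w) e c ≤-refl (subst (c <_) (sym (length-take≤ w lw b≤n)) c<b))))))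

  w-condition⁺ : ∀ c b → b ≤ n → m ≤ c → allEq x (drop c (take b w)) ≡ true
  w-condition⁺ c b b≤n m≤c = all-drop⁺ _ c (take b w) λ j c≤j j<lt →
    let j<b = subst (j <_) (length-take≤ w lw b≤n) j<lt in
    trans (cong (_≡ᵇ x) (at-take b j w j<b))
          (all-drop⁻ _ c w (stem≤⇒allEq x c w m≤c) j c≤j (subst (j <_) (sym lw) (<-≤-trans j<b b≤n)))

  v-condition⁻ : ∀ c b t → b ≤ n → all (λ b' → t <ᵇ b') (drop c (take b v)) ≡ true →
                 ∀ j → c ≤ j → j < b → t < at v j
  v-condition⁻ c b t b≤n e j c≤j j<b = <ᵇ-sound _ _ (trans (cong (t <ᵇ_) (sym (at-take b j v j<b)))
    (all-drop⁻ _ c (take b v) e j c≤j (subst (j <_) (sym (length-take≤ v lv b≤n)) j<b)))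

  v-condition⁺ : ∀ c b t → b ≤ n → (∀ j → c ≤ j → j < b → t < at v j) →
                 all (λ b' → t <ᵇ b') (drop c (take b v)) ≡ true
  v-condition⁺ c b t b≤n h = all-drop⁺ _ c (take b v) λ j c≤j j<lt →
    let j<b = subst (j <_) (length-take≤ v lv b≤n) j<lt in
    trans (cong (t <ᵇ_) (at-take b j v j<b)) (<ᵇ-complete _ _ (h j c≤j j<b))

  validMove-prefix : ∀ c b → c < b → b ≤ n → validMove x (prefix b) c ≡
    ((c <ᵇ length (take b u)) ∧ allEq x (drop c (take b w)) ∧ all (λ b' → at u c <ᵇ b') (drop c (take b v)))
  validMove-prefix c b c<b b≤n =
    validMove-unfold x (take b u) (take b v) (take b w) c (at u c) _ (drop-prefix-u c b c<b b≤n)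

  move-sound : ∀ c b → c < b → b ≤ n → validMove x (prefix b) c ≡ true → Move c b
  move-sound c b c<b b≤n e with ∧-true⁻ (c <ᵇ length (take b u)) _ (trans (sym (validMove-prefix c b c<b b≤n)) e)
  ... | _ , e' with ∧-true⁻ (allEq x (drop c (take b w))) _ e'
  ... | ew , ev = w-condition⁻ c b c<b b≤n ew , v-condition⁻ c b (at u c) b≤n ev

  move-complete : ∀ c b → c < b → b ≤ n → Move c b → validMove x (prefix b) c ≡ true
  move-complete c b c<b b≤n (m≤c , h) = trans (validMove-prefix c b c<b b≤n)
    (∧-true⁺ (trans (cong (c <ᵇ_) (length-take≤ u lu b≤n)) (<ᵇ-complete c b c<b))
             (∧-true⁺ (w-condition⁺ c b b≤n m≤c) (v-condition⁺ c b (at u c) b≤n h)))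

  kernel-prefix-elim : ∀ b → b ≤ n → K b ≡ true → ∀ c → c < b → Move c b → K c ≡ false
  kernel-prefix-elim b b≤n k c c<b mv =
    trans (cong (isKernel x) (sym (truncate-prefix c b (<⇒≤ c<b))))
      (kernel-elim x (prefix b) k c (subst (c <_) (sym (length-take≤ u lu b≤n)) c<b) (move-complete c b c<b b≤n mv))

  kernel-prefix-intro : ∀ b → b ≤ n → (∀ c → c < b → Move c b → K c ≡ false) → K b ≡ true
  kernel-prefix-intro b b≤n h = kernel-intro x (prefix b) λ c c<r vm →
    let c<b = subst (c <_) (length-take≤ u lu b≤n) c<r in
    trans (cong (isKernel x) (truncate-prefix c b (<⇒≤ c<b))) (h c c<b (move-sound c b c<b b≤n vm))

  -- No move leaves the stem, so the stem is a kernel prefix.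
  stem-kernel : K m ≡ true
  stem-kernel = kernel-prefix-intro m m≤n λ c c<m mv → ⊥-elim (<⇒≱ c<m (proj₁ mv))

  kernel-no-move : ∀ a c → c ≤ n → a < c → K a ≡ true → Move a c → K c ≡ false
  kernel-no-move a c c≤n a<c ka mv =
    ¬true⇒false (K c) (λ kc → true≢false ka (kernel-prefix-elim c c≤n kc a a<c mv))

  next-kernel : ∀ a j → m ≤ a → a ≤ j → j < n → K a ≡ true →
                (∀ i → a ≤ i → i < j → at u a < at v i) → at v j ≤ at u a → K (suc j) ≡ true
  next-kernel a j m≤a a≤j j<n ka below vj≤ua = kernel-prefix-intro (suc j) j<n options-non-kernel
    where
    options-non-kernel : ∀ c → c < suc j → Move c (suc j) → K c ≡ false
    options-non-kernel c c<sj (m≤c , mv) with <-cmp c a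
    ... | tri< c<a _ _ = kernel-prefix-elim a (≤-trans a≤j (<⇒≤ j<n)) ka c c<a
                           (m≤c , λ i c≤i i<a → mv i c≤i (≤-trans i<a (m≤n⇒m≤1+n a≤j)))
    ... | tri≈ _ refl _ = ⊥-elim (<⇒≱ (mv j a≤j ≤-refl) vj≤ua)
    ... | tri> _ _ a<c = kernel-no-move a c (≤-trans (s≤s⁻¹ c<sj) (<⇒≤ j<n)) a<c ka
                           (m≤a , λ i a≤i i<c → below i a≤i (≤-trans i<c (s≤s⁻¹ c<sj)))

  module _ (b : ℕ) (b≤n : b ≤ n) where

    ChainFrom : ℕ → Set
    ChainFrom a = ∀ a' → a < a' → a' ≤ b → K a' ≡ true →
                  K b ≡ relKernel (drop a' (take b u)) (drop a' (take b v))

    j<b : ∀ {j k} → j + suc k ≡ b → j < b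
    j<b {j} {k} e = subst (j <_) e (m<m+n j z<s)

    scan-correct : ∀ k a j → j + k ≡ b → m ≤ a → a ≤ j → a < b → K a ≡ true →
                   (∀ i → a ≤ i → i < j → at u a < at v i) → ChainFrom a →
                   K b ≡ scan (at u a) (drop (suc j) (take b u)) (drop j (take b v))
    scan-correct zero a j jb m≤a a≤j a<b ka below ih
      rewrite sym (trans (sym (+-identityʳ j)) jb) | drop-take-self j v =
      kernel-no-move a j b≤n a<b ka (m≤a , below)
    scan-correct (suc k) a j jb m≤a a≤j a<b ka below ih
      rewrite drop-at j (take b v) (subst (j <_) (sym (length-take≤ v lv b≤n)) (j<b jb)) | at-take b j v (j<b jb)
      with at u a <ᵇ at v j in eq
    ... | true = trans (scan-correct k a (suc j) (trans (sym (+-suc j k)) jb) m≤a (m≤n⇒m≤1+n a≤j) a<b ka below' ih)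
                       (cong (λ us → scan (at u a) us (drop (suc j) (take b v)))
                             (trans (cong (λ i → drop i (take b u)) (+-comm 1 (suc j))) (sym (drop-drop (suc j) 1 (take b u)))))
      where
      below' : ∀ i → a ≤ i → i < suc j → at u a < at v i
      below' i a≤i i<sj with m≤n⇒m<n∨m≡n (s≤s⁻¹ i<sj)
      ... | inj₁ i<j  = below i a≤i i<j
      ... | inj₂ refl = <ᵇ-sound _ _ eq
    ... | false = ih (suc j) (s≤s a≤j) (j<b jb)
                     (next-kernel a j m≤a a≤j (<-≤-trans (j<b jb) b≤n) ka below (<ᵇ-false-sound _ _ eq))

    kernel-chain : ∀ F a → b ≤ a + F → m ≤ a → a ≤ b → K a ≡ true →
                   K b ≡ relKernel (drop a (take b u)) (drop a (take b v))
    kernel-chain F a bF m≤a a≤b ka with m≤n⇒m<n∨m≡n a≤b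
    ... | inj₂ refl rewrite drop-take-self a u = ka
    kernel-chain zero a bF m≤a a≤b ka | inj₁ a<b = ⊥-elim (<⇒≱ a<b (subst (b ≤_) (+-identityʳ a) bF))
    kernel-chain (suc F) a bF m≤a a≤b ka | inj₁ a<b rewrite drop-prefix-u a b a<b b≤n =
      scan-correct (b ∸ a) a a (m+[n∸m]≡n a≤b) m≤a ≤-refl a<b ka (λ i a≤i i<a → ⊥-elim (<⇒≱ i<a a≤i))
        λ a' a<a' a'≤b ka' → kernel-chain F a' (≤-trans bF (subst (_≤ a' + F) (sym (+-suc a F)) (+-monoˡ-≤ F a<a')))
                               (≤-trans m≤a (<⇒≤ a<a')) a'≤b ka'

  kernel-char : isKernel x (u , v , w) ≡ relKernel (drop m u) (drop m v)
  kernel-char =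
    subst (λ w' → isKernel x (u , v , w') ≡ relKernel (drop m u) (drop m v)) (take-n w lw)
      (subst₂ (λ u' v' → isKernel x (u' , v' , take n w) ≡ relKernel (drop m u') (drop m v')) (take-n u lu) (take-n v lv)
        (kernel-chain n ≤-refl n m (m≤n+m n m) ≤-refl m≤n stem-kernel))
    where
    take-n : ∀ (l : List ℕ) → length l ≡ n → take n l ≡ l
    take-n l e = take-all n l (≤-reflexive e)

-- Binomial identities.  rising t d = t (t+1) ⋯ (t+d-1) counts words of length d
-- whose letters, in positions t, t+1, …, are bounded by the position.
rising : ℕ → ℕ → ℕ
rising t zero    = 1
rising t (suc d) = t * rising (suc t) d

rising-factorial : ∀ r d → rising (suc r) d * r ! ≡ (r + d) !
rising-factorial r zero    = trans (+-identityʳ (r !)) (cong _! (sym (+-identityʳ r)))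
rising-factorial r (suc d) = begin
  suc r * rising (2 + r) d * r !    ≡⟨ rearrange (suc r) (rising (2 + r) d) (r !) ⟩
  rising (2 + r) d * (suc r * r !) ≡⟨ rising-factorial (suc r) d ⟩
  (suc r + d) !                     ≡⟨ cong _! (sym (+-suc r d)) ⟩
  (r + suc d) !                     ∎
  where
  rearrange : ∀ a b c → a * b * c ≡ b * (a * c)
  rearrange = solve-∀

rising-1 : ∀ m → rising 1 m ≡ m !
rising-1 m = trans (sym (*-identityʳ (rising 1 m))) (rising-factorial 0 m)

rising-2 : ∀ m → rising 2 m ≡ suc m !
rising-2 m = trans (sym (*-identityʳ (rising 2 m))) (rising-factorial 1 m)

choose-factorial : ∀ {n k} → k ≤ n → (n C k) * (k ! * (n ∸ k) !) ≡ n !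
choose-factorial {n} {k} k≤n =
  trans (cong (_* (k ! * (n ∸ k) !)) (nCk≡n!/k![n-k]! k≤n)) (m/n*n≡m (k![n∸k]!∣n! k≤n))
  where instance _ = k !* (n ∸ k) !≢0

rising-choose : ∀ r d → rising (suc r) d ≡ d ! * ((r + d) C r)
rising-choose r d = *-cancelʳ-≡ _ _ (r !) {{r !≢0}} (begin
  rising (suc r) d * r !                    ≡⟨ rising-factorial r d ⟩
  (r + d) !                                 ≡⟨ sym (choose-factorial (m≤m+n r d)) ⟩
  ((r + d) C r) * (r ! * (r + d ∸ r) !)     ≡⟨ cong (λ k → ((r + d) C r) * (r ! * k !)) (m+n∸m≡n r d) ⟩
  ((r + d) C r) * (r ! * d !)               ≡⟨ rearrange ((r + d) C r) (r !) (d !) ⟩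
  d ! * ((r + d) C r) * r !                 ∎)
  where
  rearrange : ∀ a b c → a * (b * c) ≡ c * a * b
  rearrange = solve-∀

pascal-scaled : ∀ d N k → d ! * (N C suc k) + d ! * (N C k) ≡ d ! * (suc N C suc k)
pascal-scaled d N k = trans (sym (*-distribˡ-+ (d !) _ _))
  (cong (d ! *_) (trans (+-comm (N C suc k) (N C k)) (nCk+nC[k+1]≡[n+1]C[k+1] N k)))

hockey-stick : ∀ M d → Σ< (suc M) (λ c → rising (suc M ∸ c) d) ≡ d ! * ((suc M + d) C M)
hockey-stick zero    d = trans (+-identityʳ _) (rising-choose 0 d)
hockey-stick (suc M) d =
  trans (cong₂ _+_ (rising-choose (suc M) d) (hockey-stick M d)) (pascal-scaled d (suc M + d) M)

weighted-hockey-stick : ∀ a d → Σ< (suc a) (λ c → suc c * rising (suc a ∸ c) d) ≡ d ! * ((2 + a + d) C a)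
weighted-hockey-stick zero    d = trans (+-identityʳ _) (trans (+-identityʳ _) (rising-choose 0 d))
weighted-hockey-stick (suc a) d = begin
  Σ< (2 + a) (λ c → suc c * rising (2 + a ∸ c) d)
    ≡⟨ Σ<-+ (2 + a) (λ c → rising (2 + a ∸ c) d) (λ c → c * rising (2 + a ∸ c) d) ⟩
  Σ< (2 + a) (λ c → rising (2 + a ∸ c) d) + Σ< (suc a) (λ c → suc c * rising (suc a ∸ c) d)
    ≡⟨ cong₂ _+_ (hockey-stick (suc a) d) (weighted-hockey-stick a d) ⟩
  d ! * ((2 + a + d) C suc a) + d ! * ((2 + a + d) C a)
    ≡⟨ pascal-scaled d (2 + a + d) a ⟩
  d ! * ((3 + a + d) C suc a) ∎

-- runWeight t a i counts the choices of the letters read while a scan with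
-- threshold t continues for i steps: v_{a+1+k} must exceed t (a+2+k-t
-- choices) and u_{a+2+k} is skipped (a+2+k choices), for k < i.
runWeight : ℕ → ℕ → ℕ → ℕ
runWeight t a zero    = 1
runWeight t a (suc i) = (2 + a ∸ t) * (2 + a) * runWeight t (suc a) i

runWeight-rising : ∀ i a c → c ≤ a → runWeight (suc c) a i ≡ rising (suc a ∸ c) i * rising (2 + a) i
runWeight-rising zero    a c c≤a = refl
runWeight-rising (suc i) a c c≤a = begin
  (suc a ∸ c) * (2 + a) * runWeight (suc c) (suc a) i
    ≡⟨ cong ((suc a ∸ c) * (2 + a) *_) (runWeight-rising i (suc a) c (m≤n⇒m≤1+n c≤a)) ⟩
  (suc a ∸ c) * (2 + a) * (rising (2 + a ∸ c) i * rising (3 + a) i)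
    ≡⟨ cong (λ k → (suc a ∸ c) * (2 + a) * (rising k i * rising (3 + a) i)) (+-∸-assoc 1 (m≤n⇒m≤1+n c≤a)) ⟩
  (suc a ∸ c) * (2 + a) * (rising (suc (suc a ∸ c)) i * rising (3 + a) i)
    ≡⟨ rearrange (suc a ∸ c) (2 + a) _ _ ⟩
  (suc a ∸ c) * rising (suc (suc a ∸ c)) i * ((2 + a) * rising (3 + a) i) ∎
  where
  rearrange : ∀ p q r s → p * q * (r * s) ≡ p * r * (q * s)
  rearrange = solve-∀

-- The total weight of one step a → a+1+i of the kernel chain, summed over the
-- letter u_{a+1} = c+1 (c+1 choices of the first failing letter of v), is the
-- factor (i!)² (a+1+i choose a+1) (a+2+i choose a) of the formula.
step-weight : ∀ a i → Σ< (suc a) (λ c → suc c * runWeight (suc c) a i) ≡ stepF a (suc a + i)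
step-weight a i = begin
  Σ< (suc a) (λ c → suc c * runWeight (suc c) a i)
    ≡⟨ Σ<-cong (suc a) (λ c c≤a → trans (cong (suc c *_) (runWeight-rising i a c (s≤s⁻¹ c≤a)))
                                          (sym (*-assoc (suc c) (rising (suc a ∸ c) i) _))) ⟩
  Σ< (suc a) (λ c → suc c * rising (suc a ∸ c) i * rising (2 + a) i)
    ≡⟨ Σ<-*ʳ (suc a) (rising (2 + a) i) (λ c → suc c * rising (suc a ∸ c) i) ⟩
  Σ< (suc a) (λ c → suc c * rising (suc a ∸ c) i) * rising (2 + a) i
    ≡⟨ cong₂ _*_ (weighted-hockey-stick a i) (rising-choose (suc a) i) ⟩
  i ! * ((2 + a + i) C a) * (i ! * ((suc a + i) C suc a))
    ≡⟨ rearrange (i !) _ _ ⟩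
  i ! * i ! * ((suc a + i) C suc a) * ((2 + a + i) C a)
    ≡⟨ sym (cong₂ (λ g k → g ! * g ! * ((suc a + i) C k) * ((2 + a + i) C a)) gap (+-comm a 1)) ⟩
  (suc a + i ∸ a ∸ 1) ! * (suc a + i ∸ a ∸ 1) ! * ((suc a + i) C (a + 1)) * ((2 + a + i) C a)
    ≡⟨ cong (λ k → (suc a + i ∸ a ∸ 1) ! * (suc a + i ∸ a ∸ 1) ! * ((suc a + i) C (a + 1)) * (k C a))
            (+-comm 1 (suc a + i)) ⟩
  stepF a (suc a + i) ∎
  where
  rearrange : ∀ p q r → p * q * (p * r) ≡ p * p * r * q
  rearrange = solve-∀
  gap : suc a + i ∸ a ∸ 1 ≡ i
  gap = cong (_∸ 1) (trans (cong (_∸ a) (sym (+-suc a i))) (m+n∸m≡n a (suc i)))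

-- Counting relative kernels.  In position i (1-based) the letters of u range
-- over 1 … i and those of v over 1 … i+1.
bound-u bound-v : ℕ → ℕ
bound-u i = i
bound-v i = suc i

-- G a d: the number of continuations (us , vs) of length d of a kernel prefix
-- of length a for which the kernel chain ends exactly at a + d.
G : ℕ → ℕ → ℕ
G a d = ΣW bound-u (suc a) d (λ us → ΣW bound-v (suc a) d (λ vs → ind (relKernel us vs)))

-- Continuations in the middle of a scan with threshold t: `scanCount` after the
-- letter u_{a+1} was read, `scanCount′` after the letters u_{a+2}, v_{a+1} were too.
scanCount : ℕ → ℕ → ℕ → ℕ
scanCount t a d = ΣW bound-u (2 + a) d (λ us → ΣW bound-v (suc a) (suc d) (λ vs → ind (scan t us vs)))

scanCount′ : ℕ → ℕ → ℕ → ℕ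
scanCount′ t a d = ΣW bound-u (2 + a) d (λ us → ΣW bound-v (2 + a) d (λ vs → ind (scan t (drop 1 us) vs)))

count-exceeding : ∀ N t (A B : ℕ) → t ≤ N → Σ< N (λ e → if t <ᵇ suc e then A else B) ≡ (N ∸ t) * A + t * B
count-exceeding N       zero    A B _         = trans (Σ<-const N A) (sym (+-identityʳ (N * A)))
count-exceeding (suc N) (suc t) A B (s≤s t≤N) =
  trans (cong (B +_) (count-exceeding N t A B t≤N)) (rearrange (N ∸ t) A t B)
  where
  rearrange : ∀ p A t B → B + (p * A + t * B) ≡ p * A + (B + t * B)
  rearrange = solve-∀

-- Reading the letter v_{a+1}: the scan goes on if it exceeds t, and otherwise
-- the chain has reached its next kernel prefix a + 1.
scanCount-step : ∀ t a d → t ≤ 2 + a → scanCount t a d ≡ (2 + a ∸ t) * scanCount′ t a d + t * G (suc a) d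
scanCount-step t a d t≤ = begin
  scanCount t a d
    ≡⟨ ΣW-ext bound-u (2 + a) d (λ us → trans
         (Σ<-ext (2 + a) (λ e → trans
            (ΣW-ext bound-v (2 + a) d (λ vs → ind-if (t <ᵇ suc e) (scan t (drop 1 us) vs) (relKernel us vs)))
            (ΣW-if bound-v (2 + a) d (t <ᵇ suc e) (λ vs → ind (scan t (drop 1 us) vs)) (λ vs → ind (relKernel us vs)))))
         (count-exceeding (2 + a) t _ _ t≤)) ⟩
  ΣW bound-u (2 + a) d (λ us → (2 + a ∸ t) * ΣW bound-v (2 + a) d (λ vs → ind (scan t (drop 1 us) vs))
                              + t * ΣW bound-v (2 + a) d (λ vs → ind (relKernel us vs)))
    ≡⟨ ΣW-+ bound-u (2 + a) d _ _ ⟩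
  _ ≡⟨ cong₂ _+_ (ΣW-*ˡ bound-u (2 + a) d (2 + a ∸ t) _) (ΣW-*ˡ bound-u (2 + a) d t _) ⟩
  (2 + a ∸ t) * scanCount′ t a d + t * G (suc a) d ∎

-- Reading the letter u_{a+2}, which the scan skips, gives a factor 2 + a.
scanCount′-step : ∀ t a d → scanCount′ t a (suc d) ≡ (2 + a) * scanCount t (suc a) d
scanCount′-step t a d = Σ<-const (2 + a) (scanCount t (suc a) d)

scanCount-closed : ∀ d a t → t ≤ suc a →
                   scanCount t a d ≡ Σ< (suc d) (λ i → t * runWeight t a i * G (suc a + i) (d ∸ i))
scanCount-closed zero a t t≤ =
  trans (scanCount-step t a 0 (m≤n⇒m≤1+n t≤))
        (trans (cong (λ k → (2 + a ∸ t) * 0 + t * G k 0) (sym (+-identityʳ (suc a)))) (rearrange (2 + a ∸ t) t))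
  where
  rearrange : ∀ p t → p * 0 + t * 1 ≡ t * 1 * 1 + 0
  rearrange = solve-∀
scanCount-closed (suc d) a t t≤ = begin
  scanCount t a (suc d)
    ≡⟨ trans (scanCount-step t a (suc d) (m≤n⇒m≤1+n t≤))
             (cong (λ k → α * k + t * G (suc a) (suc d)) (scanCount′-step t a d)) ⟩
  α * ((2 + a) * scanCount t (suc a) d) + t * G (suc a) (suc d)
    ≡⟨ cong (λ k → α * ((2 + a) * k) + t * G (suc a) (suc d)) (scanCount-closed d (suc a) t (m≤n⇒m≤1+n t≤)) ⟩
  α * ((2 + a) * S) + t * G (suc a) (suc d)
    ≡⟨ rearrange α (2 + a) S t (G (suc a) (suc d)) ⟩
  t * 1 * G (suc a) (suc d) + α * (2 + a) * S
    ≡⟨ cong₂ _+_ (cong (λ k → t * 1 * G k (suc d)) (sym (+-identityʳ (suc a))))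
                 (sym (Σ<-*ˡ (suc d) (α * (2 + a)) (λ i → t * runWeight t (suc a) i * G (2 + a + i) (d ∸ i)))) ⟩
  t * 1 * G (suc a + 0) (suc d) + Σ< (suc d) (λ i → α * (2 + a) * (t * runWeight t (suc a) i * G (2 + a + i) (d ∸ i)))
    ≡⟨ cong (t * 1 * G (suc a + 0) (suc d) +_) (Σ<-ext (suc d) (λ i →
         trans (rearrange′ α (2 + a) t (runWeight t (suc a) i) _)
               (cong (λ k → t * (α * (2 + a) * runWeight t (suc a) i) * G k (d ∸ i)) (sym (+-suc (suc a) i))))) ⟩
  Σ< (2 + d) (λ i → t * runWeight t a i * G (suc a + i) (suc d ∸ i)) ∎
  where
  α = 2 + a ∸ t
  S = Σ< (suc d) (λ i → t * runWeight t (suc a) i * G (2 + a + i) (d ∸ i))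
  rearrange : ∀ α β S t G → α * (β * S) + t * G ≡ t * 1 * G + α * β * S
  rearrange = solve-∀
  rearrange′ : ∀ α β t q G → α * β * (t * q * G) ≡ t * (α * β * q) * G
  rearrange′ = solve-∀

G-step : ∀ a d → G a (suc d) ≡ Σ< (suc d) (λ i → stepF a (suc a + i) * G (suc a + i) (d ∸ i))
G-step a d = begin
  Σ< (suc a) (λ c → scanCount (suc c) a d)
    ≡⟨ Σ<-cong (suc a) (λ c c< → scanCount-closed d a (suc c) c<) ⟩
  Σ< (suc a) (λ c → Σ< (suc d) (λ i → suc c * runWeight (suc c) a i * G (suc a + i) (d ∸ i)))
    ≡⟨ Σ<-swap (suc a) (suc d) (λ c i → suc c * runWeight (suc c) a i * G (suc a + i) (d ∸ i)) ⟩
  Σ< (suc d) (λ i → Σ< (suc a) (λ c → suc c * runWeight (suc c) a i * G (suc a + i) (d ∸ i)))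
    ≡⟨ Σ<-ext (suc d) (λ i → trans (Σ<-*ʳ (suc a) (G (suc a + i) (d ∸ i)) (λ c → suc c * runWeight (suc c) a i))
                                  (cong (_* G (suc a + i) (d ∸ i)) (step-weight a i))) ⟩
  Σ< (suc d) (λ i → stepF a (suc a + i) * G (suc a + i) (d ∸ i)) ∎

-- The chain sums of the formula.  chainSum a n sums the products of step
-- factors over all chains a = i₀ < i₁ < ⋯ < i_{k+1} = n; chainSum₁ also counts
-- the empty chain a = n with weight 1.
chainSum : ℕ → ℕ → ℕ
chainSum a n = Σ< (n ∸ a) (λ k → chains k a n)

chainSum₁ : ℕ → ℕ → ℕ
chainSum₁ a n = if a <ᵇ n then chainSum a n else 1

chains-vanish : ∀ k a n → n ≤ a + k → chains k a n ≡ 0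
chains-vanish zero    a n n≤ rewrite <ᵇ-false-complete a n (subst (n ≤_) (+-identityʳ a) n≤) = refl
chains-vanish (suc k) a n n≤ = trans (sumBelow≡Σ< n _) (trans (Σ<-ext n term) (Σ<-0 n))
  where
  term : ∀ b → (if a <ᵇ b then stepF a b * chains k b n else 0) ≡ 0
  term b with a <ᵇ b in eq
  ... | false = refl
  ... | true  = trans (cong (stepF a b *_) (chains-vanish k b n
                  (≤-trans n≤ (subst (_≤ b + k) (sym (+-suc a k)) (+-monoˡ-≤ k (<ᵇ-sound a b eq))))))
                  (*-zeroʳ (stepF a b))

chains-first-step : ∀ D a n → Σ< D (λ k → chains (suc k) a n) ≡
                    Σ< n (λ b → if a <ᵇ b then stepF a b * Σ< D (λ k → chains k b n) else 0)
chains-first-step D a n = begin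
  Σ< D (λ k → chains (suc k) a n)
    ≡⟨ Σ<-ext D (λ k → sumBelow≡Σ< n _) ⟩
  Σ< D (λ k → Σ< n (λ b → if a <ᵇ b then stepF a b * chains k b n else 0))
    ≡⟨ Σ<-swap D n (λ k b → if a <ᵇ b then stepF a b * chains k b n else 0) ⟩
  Σ< n (λ b → Σ< D (λ k → if a <ᵇ b then stepF a b * chains k b n else 0))
    ≡⟨ Σ<-ext n factor ⟩
  Σ< n (λ b → if a <ᵇ b then stepF a b * Σ< D (λ k → chains k b n) else 0) ∎
  where
  factor : ∀ b → Σ< D (λ k → if a <ᵇ b then stepF a b * chains k b n else 0) ≡
                 (if a <ᵇ b then stepF a b * Σ< D (λ k → chains k b n) else 0)
  factor b with a <ᵇ b
  ... | true  = Σ<-*ˡ D (stepF a b) _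
  ... | false = Σ<-0 D

chainSum-extend : ∀ D b n → n ∸ b ≤ D → b ≤ n → Σ< D (λ k → chains k b n) ≡ chainSum b n
chainSum-extend D b n e≤D b≤n = begin
  Σ< D (λ k → chains k b n)
    ≡⟨ cong (λ D → Σ< D (λ k → chains k b n)) (sym (m+[n∸m]≡n e≤D)) ⟩
  Σ< ((n ∸ b) + (D ∸ (n ∸ b))) (λ k → chains k b n)
    ≡⟨ Σ<-vanish (n ∸ b) (D ∸ (n ∸ b)) _ (λ k e≤k → chains-vanish k b n
         (subst (_≤ b + k) (m+[n∸m]≡n b≤n) (+-monoʳ-≤ b e≤k))) ⟩
  chainSum b n ∎

-- chainSum satisfies the recursion of G-step: sum over the first step a → a+1+i.
chainSum-step : ∀ a d n → suc a + d ≡ n →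
                chainSum a n ≡ Σ< (suc d) (λ i → stepF a (suc a + i) * chainSum₁ (suc a + i) n)
chainSum-step a d n refl = begin
  chainSum a n
    ≡⟨ cong (λ k → Σ< k (λ k → chains k a n)) n∸a ⟩
  chains 0 a n + Σ< d (λ k → chains (suc k) a n)
    ≡⟨ cong₂ _+_ (cong (if_then stepF a n else 0) (<ᵇ-complete a n (m≤m+n (suc a) d))) (chains-first-step d a n) ⟩
  stepF a n + Σ< (suc a + d) g
    ≡⟨ cong (stepF a n +_) (Σ<-split (suc a) d g) ⟩
  stepF a n + (Σ< (suc a) g + Σ< d (λ i → g (suc a + i)))
    ≡⟨ cong (λ k → stepF a n + (k + Σ< d (λ i → g (suc a + i)))) (trans (Σ<-cong (suc a) low) (Σ<-0 (suc a))) ⟩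
  stepF a n + Σ< d (λ i → g (suc a + i))
    ≡⟨ trans (+-comm (stepF a n) _) (cong₂ _+_ (Σ<-cong d high) last) ⟩
  Σ< d (λ i → stepF a (suc a + i) * chainSum₁ (suc a + i) n) + stepF a (suc a + d) * chainSum₁ (suc a + d) n
    ≡⟨ sym (Σ<-last d (λ i → stepF a (suc a + i) * chainSum₁ (suc a + i) n)) ⟩
  Σ< (suc d) (λ i → stepF a (suc a + i) * chainSum₁ (suc a + i) n) ∎
  where
  n∸a : n ∸ a ≡ suc d
  n∸a = trans (cong (_∸ a) (sym (+-suc a d))) (m+n∸m≡n a (suc d))
  g : ℕ → ℕ
  g b = if a <ᵇ b then stepF a b * Σ< d (λ k → chains k b n) else 0
  low : ∀ b → b < suc a → g b ≡ 0
  low b b< rewrite <ᵇ-false-complete a b (s≤s⁻¹ b<) = refl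
  last : stepF a n ≡ stepF a n * chainSum₁ n n
  last rewrite <ᵇ-false-complete n n ≤-refl = sym (*-identityʳ (stepF a n))
  high : ∀ i → i < d → g (suc a + i) ≡ stepF a (suc a + i) * chainSum₁ (suc a + i) n
  high i i<d rewrite <ᵇ-complete a (suc a + i) (s≤s (m≤m+n a i))
                   | <ᵇ-complete (suc a + i) n (+-monoʳ-< (suc a) i<d) =
    cong (stepF a (suc a + i) *_) (chainSum-extend d (suc a + i) n steps≤d (+-monoʳ-≤ (suc a) (<⇒≤ i<d)))
    where
    steps≤d : n ∸ (suc a + i) ≤ d
    steps≤d = subst (n ∸ (suc a + i) ≤_) (m+n∸m≡n (suc a) d) (∸-monoʳ-≤ n (m≤m+n (suc a) i))

G≡chainSum₁ : ∀ F d a n → d ≤ F → a + d ≡ n → G a d ≡ chainSum₁ a n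
G≡chainSum₁ F zero a n _ refl rewrite <ᵇ-false-complete a (a + 0) (≤-reflexive (+-identityʳ a)) = refl
G≡chainSum₁ (suc F) (suc d) a n (s≤s d≤F) refl = begin
  G a (suc d)
    ≡⟨ G-step a d ⟩
  Σ< (suc d) (λ i → stepF a (suc a + i) * G (suc a + i) (d ∸ i))
    ≡⟨ Σ<-cong (suc d) (λ i i< → cong (stepF a (suc a + i) *_)
         (G≡chainSum₁ F (d ∸ i) (suc a + i) n (≤-trans (m∸n≤m d i) d≤F) (ends i i<))) ⟩
  Σ< (suc d) (λ i → stepF a (suc a + i) * chainSum₁ (suc a + i) n)
    ≡⟨ sym (chainSum-step a d n (sym (+-suc a d))) ⟩
  chainSum a n
    ≡⟨ cong (if_then chainSum a n else 1) (sym (<ᵇ-complete a n (subst (suc a ≤_) (sym (+-suc a d)) (m≤m+n (suc a) d)))) ⟩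
  chainSum₁ a n ∎
  where
  ends : ∀ i → i < suc d → suc a + i + (d ∸ i) ≡ n
  ends i i< = trans (+-assoc (suc a) i (d ∸ i)) (trans (cong (suc a +_) (m+[n∸m]≡n (s≤s⁻¹ i<))) (sym (+-suc a d)))

-- Counting the words w.  multichoose k m = (k+m-1 choose m) is the number of
-- nondecreasing words of length m over an alphabet of k letters.
multichoose : ℕ → ℕ → ℕ
multichoose k m = (k + m ∸ 1) C m

multichoose-0 : ∀ m → multichoose 0 (suc m) ≡ 0
multichoose-0 m = k>n⇒nCk≡0 (n<1+n m)

multichoose-pascal : ∀ k m → multichoose (suc k) (suc m) ≡ multichoose (suc k) m + multichoose k (suc m)
multichoose-pascal k m = begin
  (k + suc m) C suc m                ≡⟨ cong (_C suc m) (+-suc k m) ⟩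
  suc (k + m) C suc m                ≡⟨ sym (nCk+nC[k+1]≡[n+1]C[k+1] (k + m) m) ⟩
  (k + m) C m + (k + m) C suc m      ≡⟨ cong (λ s → (k + m) C m + (s ∸ 1) C suc m) (sym (+-suc k m)) ⟩
  multichoose (suc k) m + multichoose k (suc m) ∎

nondecFrom : ℕ → List ℕ → Bool
nondecFrom lo []      = true
nondecFrom lo (a ∷ w) = (lo ≤ᵇ a) ∧ nondecFrom a w

nondecreasing-cons : ∀ a l → nondecreasing (a ∷ l) ≡ nondecFrom a l
nondecreasing-cons a []      = refl
nondecreasing-cons a (b ∷ l) = cong ((a ≤ᵇ b) ∧_) (nondecreasing-cons b l)

ind-<ᵇ-suc : ∀ l a → ind (l <ᵇ suc a) ≡ ind (a ≡ᵇ l) + ind (l <ᵇ a)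
ind-<ᵇ-suc zero    zero    = refl
ind-<ᵇ-suc zero    (suc a) = refl
ind-<ᵇ-suc (suc l) zero    = refl
ind-<ᵇ-suc (suc l) (suc a) = ind-<ᵇ-suc l a

split-least-letter : ∀ x l (f : ℕ → ℕ) → l < x →
  Σ< x (λ a → ind (suc l ≤ᵇ suc a) * f a) ≡ f l + Σ< x (λ a → ind (2 + l ≤ᵇ suc a) * f a)
split-least-letter x l f l<x = begin
  Σ< x (λ a → ind (l <ᵇ suc a) * f a)
    ≡⟨ Σ<-ext x (λ a → trans (cong (_* f a) (ind-<ᵇ-suc l a)) (*-distribʳ-+ (f a) (ind (a ≡ᵇ l)) _)) ⟩
  Σ< x (λ a → ind (a ≡ᵇ l) * f a + ind (l <ᵇ a) * f a)
    ≡⟨ Σ<-+ x _ _ ⟩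
  Σ< x (λ a → ind (a ≡ᵇ l) * f a) + Σ< x (λ a → ind (l <ᵇ a) * f a)
    ≡⟨ cong (_+ Σ< x (λ a → ind (l <ᵇ a) * f a)) (Σ<-delta x l f l<x) ⟩
  f l + Σ< x (λ a → ind (2 + l ≤ᵇ suc a) * f a) ∎

module StemCount (x' : ℕ) where

  x : ℕ
  x = suc x'

  bound-x : ℕ → ℕ
  bound-x _ = x

  stemCount : ℕ → ℕ → ℕ → ℕ
  stemCount n lo m = ΣW bound-x 0 n (λ w → ind (nondecFrom lo w) * ind (m ≡ᵇ stem x w))

  stemCountAt : ℕ → ℕ → ℕ → ℕ
  stemCountAt n m a = ΣW bound-x 0 n (λ w → ind (nondecFrom (suc a) w) * ind (m ≡ᵇ stem x (suc a ∷ w)))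

  first-letter : ∀ n lo (H : List ℕ → ℕ) →
    ΣW bound-x 0 (suc n) (λ w → ind (nondecFrom lo w) * H w) ≡
    Σ< x (λ a → ind (lo ≤ᵇ suc a) * ΣW bound-x 0 n (λ w → ind (nondecFrom (suc a) w) * H (suc a ∷ w)))
  first-letter n lo H = Σ<-ext x λ a → trans (ΣW-const-start x 1 0 n _)
    (trans (ΣW-ext bound-x 0 n (λ w → trans (cong (_* H (suc a ∷ w)) (ind-∧ (lo ≤ᵇ suc a) (nondecFrom (suc a) w)))
                                             (*-assoc (ind (lo ≤ᵇ suc a)) _ _)))
           (ΣW-*ˡ bound-x 0 n (ind (lo ≤ᵇ suc a)) _))

  no-letter-above-x : ∀ (f : ℕ → ℕ) → Σ< x (λ a → ind (suc x ≤ᵇ suc a) * f a) ≡ 0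
  no-letter-above-x f = trans (Σ<-cong x (λ a a<x → cong (λ b → ind b * f a) (<ᵇ-false-complete x (suc a) a<x))) (Σ<-0 x)

  stemCount-least : ∀ n l m → l < x → stemCount (suc n) (suc l) m ≡ stemCountAt n m l + stemCount (suc n) (2 + l) m
  stemCount-least n l m l<x =
    trans (first-letter n (suc l) (λ w → ind (m ≡ᵇ stem x w)))
      (trans (split-least-letter x l (stemCountAt n m) l<x)
             (cong (stemCountAt n m l +_) (sym (first-letter n (2 + l) (λ w → ind (m ≡ᵇ stem x w))))))

  stemCount-empty : ∀ n m → stemCount (suc n) (suc x) m ≡ 0
  stemCount-empty n m = trans (first-letter n (suc x) (λ w → ind (m ≡ᵇ stem x w))) (no-letter-above-x (stemCountAt n m))

  nondecFrom-x : ∀ s n w → Fits bound-x s n w → nondecFrom x w ≡ true → allEq x w ≡ true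
  nondecFrom-x s zero    []          []         _ = refl
  nondecFrom-x s (suc n) (suc a ∷ w) (a<x ∷ fw) e with ∧-true⁻ (x ≤ᵇ suc a) _ e
  ... | x≤a , rest with ≤-antisym a<x (≤ᵇ-sound x (suc a) x≤a)
  ... | refl = trans (cong (_∧ allEq x w) (≡ᵇ-complete x x refl)) (nondecFrom-x (suc s) n w fw rest)

  constant-x : ∀ n → ΣW bound-x 0 n (λ w → ind (nondecFrom x w) * 1) ≡ 1
  constant-x zero    = refl
  constant-x (suc n) =
    trans (first-letter n x (λ _ → 1))
      (trans (split-least-letter x x' (λ a → ΣW bound-x 0 n (λ w → ind (nondecFrom (suc a) w) * 1)) ≤-refl)
             (cong₂ _+_ (constant-x n) (no-letter-above-x (λ a → ΣW bound-x 0 n (λ w → ind (nondecFrom (suc a) w) * 1)))))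

  stemCountAt-x : ∀ n m → stemCountAt n m x' ≡ ind (m ≡ᵇ 0)
  stemCountAt-x n m = begin
    stemCountAt n m x'                                        ≡⟨ ΣW-cong bound-x 0 n constant ⟩
    ΣW bound-x 0 n (λ w → ind (m ≡ᵇ 0) * (ind (nondecFrom x w) * 1)) ≡⟨ ΣW-*ˡ bound-x 0 n (ind (m ≡ᵇ 0)) _ ⟩
    ind (m ≡ᵇ 0) * ΣW bound-x 0 n (λ w → ind (nondecFrom x w) * 1) ≡⟨ cong (ind (m ≡ᵇ 0) *_) (constant-x n) ⟩
    ind (m ≡ᵇ 0) * 1                                          ≡⟨ *-identityʳ _ ⟩
    ind (m ≡ᵇ 0)                                              ∎
    where
    constant : ∀ w → Fits bound-x 0 n w →
               ind (nondecFrom x w) * ind (m ≡ᵇ stem x (x ∷ w)) ≡ ind (m ≡ᵇ 0) * (ind (nondecFrom x w) * 1)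
    constant w fw with nondecFrom x w in eq
    ... | false = sym (*-zeroʳ (ind (m ≡ᵇ 0)))
    ... | true rewrite ≡ᵇ-complete x x refl | nondecFrom-x 0 n w fw eq =
      trans (+-identityʳ (ind (m ≡ᵇ 0))) (sym (*-identityʳ (ind (m ≡ᵇ 0))))

  stem-below-x : ∀ l w → l < x' → stem x (suc l ∷ w) ≡ suc (stem x w)
  stem-below-x l w l<x' rewrite <⇒≡ᵇ-false l x' l<x' = refl

  stemCountAt-0 : ∀ n l → l < x' → stemCountAt n 0 l ≡ 0
  stemCountAt-0 n l l<x' = trans (ΣW-ext bound-x 0 n (λ w →
      trans (cong (λ s → ind (nondecFrom (suc l) w) * ind (0 ≡ᵇ s)) (stem-below-x l w l<x'))
            (*-zeroʳ (ind (nondecFrom (suc l) w)))))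
    (ΣW-const bound-x 0 n 0)

  stemCountAt-suc : ∀ n l m → l < x' → stemCountAt n (suc m) l ≡ stemCount n (suc l) m
  stemCountAt-suc n l m l<x' = ΣW-ext bound-x 0 n (λ w →
    cong (λ s → ind (nondecFrom (suc l) w) * ind (suc m ≡ᵇ s)) (stem-below-x l w l<x'))

  -- Stem m over the letters lo … x: a nondecreasing word of length m over the
  -- k = x - lo letters lo … x-1, followed by letters x.
  stemCount-closed : ∀ n k lo m → lo + k ≡ x → 1 ≤ lo → m ≤ n → stemCount n lo m ≡ multichoose k m
  stemCount-closed zero k lo zero e _ _ = refl
  stemCount-closed (suc n) zero lo m e _ _ =
    subst (λ l → stemCount (suc n) l m ≡ multichoose 0 m) (sym (trans (sym (+-identityʳ lo)) e))
      (trans (stemCount-least n x' m ≤-refl) (trans (cong₂ _+_ (stemCountAt-x n m) (stemCount-empty n m)) (only-x m)))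
    where
    only-x : ∀ m → ind (m ≡ᵇ 0) + 0 ≡ multichoose 0 m
    only-x zero    = refl
    only-x (suc m) = sym (multichoose-0 m)
  stemCount-closed (suc n) (suc k) (suc l) m e (s≤s z≤n) m≤ =
    trans (stemCount-least n l m l<x)
      (trans (cong (stemCountAt n m l +_) (stemCount-closed (suc n) k (2 + l) m e' (s≤s z≤n) m≤)) (by-first-letter m m≤))
    where
    e' : 2 + l + k ≡ x
    e' = trans (sym (+-suc (suc l) k)) e
    l<x' : l < x'
    l<x' = s≤s⁻¹ (subst (2 + l ≤_) e (s≤s (subst (suc l ≤_) (sym (+-suc l k)) (s≤s (m≤m+n l k)))))
    l<x : l < x
    l<x = m≤n⇒m≤1+n l<x'
    by-first-letter : ∀ m → m ≤ suc n → stemCountAt n m l + multichoose k m ≡ multichoose (suc k) m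
    by-first-letter zero    _         = cong (_+ 1) (stemCountAt-0 n l l<x')
    by-first-letter (suc m) (s≤s m≤n) =
      trans (cong (_+ multichoose k (suc m)) (trans (stemCountAt-suc n l m l<x')
                                                    (stemCount-closed n (suc k) (suc l) m e (s≤s z≤n) m≤n)))
            (sym (multichoose-pascal k m))

  stemCount-binomX : ∀ n m → m ≤ n → stemCount n 1 m ≡ binomX x m
  stemCount-binomX n m m≤n = stemCount-closed n x' 1 m refl (s≤s z≤n) m≤n

-- The pairs (u , v) for a given stem m.  Their first m letters are free, giving
-- m! (m+1)! choices; the rest is counted by G.
count-bound-u : ∀ s d → ΣW bound-u s d (λ _ → 1) ≡ rising s d
count-bound-u s zero    = refl
count-bound-u s (suc d) = trans (Σ<-ext s (λ _ → count-bound-u (suc s) d)) (Σ<-const s (rising (suc s) d))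

count-bound-v : ∀ s d → ΣW bound-v s d (λ _ → 1) ≡ rising (suc s) d
count-bound-v s zero    = refl
count-bound-v s (suc d) = trans (Σ<-ext (suc s) (λ _ → count-bound-v (suc s) d)) (Σ<-const (suc s) (rising (2 + s) d))

kernelsWithStem : ℕ → ℕ → ℕ
kernelsWithStem n m = ΣW bound-u 1 n (λ u → ΣW bound-v 1 n (λ v → ind (relKernel (drop m u) (drop m v))))

kernelsWithStem-closed : ∀ m d → kernelsWithStem (m + d) m ≡ m ! * (suc m ! * G m d)
kernelsWithStem-closed m d = begin
  kernelsWithStem (m + d) m
    ≡⟨ ΣW-split bound-u 1 m d _ ⟩
  ΣW bound-u 1 m (λ p → ΣW bound-u (suc m) d (λ q →
    ΣW bound-v 1 (m + d) (λ v → ind (relKernel (drop m (p ++ q)) (drop m v)))))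
    ≡⟨ ΣW-cong bound-u 1 m (λ p fp → ΣW-ext bound-u (suc m) d (λ q → trans (ΣW-split bound-v 1 m d _)
         (ΣW-cong bound-v 1 m (λ p' fp' → ΣW-ext bound-v (suc m) d (λ q' →
            cong₂ (λ us vs → ind (relKernel us vs)) (drop-prefix p q fp) (drop-prefix p' q' fp')))))) ⟩
  ΣW bound-u 1 m (λ p → ΣW bound-u (suc m) d (λ q →
    ΣW bound-v 1 m (λ p' → ΣW bound-v (suc m) d (λ q' → ind (relKernel q q')))))
    ≡⟨ ΣW-ext bound-u 1 m (λ p → ΣW-swap bound-u (suc m) d bound-v 1 m _) ⟩
  ΣW bound-u 1 m (λ p → ΣW bound-v 1 m (λ p' → G m d))
    ≡⟨ ΣW-ext bound-u 1 m (λ p → trans (ΣW-const bound-v 1 m (G m d))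
                                       (cong (G m d *_) (trans (count-bound-v 1 m) (rising-2 m)))) ⟩
  ΣW bound-u 1 m (λ p → G m d * suc m !)
    ≡⟨ trans (ΣW-const bound-u 1 m _) (cong (G m d * suc m ! *_) (trans (count-bound-u 1 m) (rising-1 m))) ⟩
  G m d * suc m ! * m !
    ≡⟨ rearrange (G m d) (suc m !) (m !) ⟩
  m ! * (suc m ! * G m d) ∎
  where
  drop-prefix : ∀ {b} (p q : List ℕ) → Fits b 1 m p → drop m (p ++ q) ≡ q
  drop-prefix p q fp = subst (λ k → drop k (p ++ q) ≡ q) (Fits-length fp) (drop-++ p q)
  rearrange : ∀ a b c → a * b * c ≡ c * (b * a)
  rearrange = solve-∀

-- The validity conditions on u and v are the position-dependent alphabets.
truncate-sum : ∀ b K (f : ℕ → ℕ) → K ≤ b → Σ< b (λ a → ind (a <ᵇ K) * f a) ≡ Σ< K f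
truncate-sum b K f K≤b = begin
  Σ< b (λ a → ind (a <ᵇ K) * f a)
    ≡⟨ cong (λ k → Σ< k (λ a → ind (a <ᵇ K) * f a)) (sym (m+[n∸m]≡n K≤b)) ⟩
  Σ< (K + (b ∸ K)) (λ a → ind (a <ᵇ K) * f a)
    ≡⟨ Σ<-vanish K (b ∸ K) _ (λ i K≤i → cong (λ c → ind c * f i) (<ᵇ-false-complete i K K≤i)) ⟩
  Σ< K (λ a → ind (a <ᵇ K) * f a)
    ≡⟨ Σ<-cong K (λ a a<K → trans (cong (λ c → ind c * f a) (<ᵇ-complete a K a<K)) (+-identityʳ (f a))) ⟩
  Σ< K f ∎

boundedFrom-alphabet : ∀ c s n b (F : List ℕ → ℕ) → s + c + n ≤ suc b →
  ΣW (λ _ → b) s n (λ w → ind (boundedFrom c s w) * F w) ≡ ΣW (λ i → i + c) s n F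
boundedFrom-alphabet c s zero    b F _  = +-identityʳ (F [])
boundedFrom-alphabet c s (suc n) b F le = begin
  Σ< b (λ a → ΣW (λ _ → b) (suc s) n (λ w → ind ((a <ᵇ s + c) ∧ boundedFrom c (suc s) w) * F (suc a ∷ w)))
    ≡⟨ Σ<-ext b (λ a → trans (ΣW-ext (λ _ → b) (suc s) n (λ w →
                                trans (cong (_* F (suc a ∷ w)) (ind-∧ (a <ᵇ s + c) _)) (*-assoc (ind (a <ᵇ s + c)) _ _)))
                      (trans (ΣW-*ˡ (λ _ → b) (suc s) n (ind (a <ᵇ s + c)) _)
                             (cong (ind (a <ᵇ s + c) *_) (boundedFrom-alphabet c (suc s) n b (λ w → F (suc a ∷ w)) le')))) ⟩
  Σ< b (λ a → ind (a <ᵇ s + c) * ΣW (λ i → i + c) (suc s) n (λ w → F (suc a ∷ w)))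
    ≡⟨ truncate-sum b (s + c) _ K≤b ⟩
  ΣW (λ i → i + c) s (suc n) F ∎
  where
  le' : suc s + c + n ≤ suc b
  le' = subst (_≤ suc b) (+-suc (s + c) n) le
  K≤b : s + c ≤ b
  K≤b = s≤s⁻¹ (≤-trans (s≤s (m≤m+n (s + c) n)) le')

uv-alphabets : ∀ n (R : List ℕ → List ℕ → ℕ) →
  ΣW (λ _ → n) 1 n (λ u → ind (boundedFrom 0 1 u) * ΣW (λ _ → suc n) 1 n (λ v → ind (boundedFrom 1 1 v) * R u v))
  ≡ ΣW bound-u 1 n (λ u → ΣW bound-v 1 n (R u))
uv-alphabets n R = begin
  ΣW (λ _ → n) 1 n (λ u → ind (boundedFrom 0 1 u) * ΣW (λ _ → suc n) 1 n (λ v → ind (boundedFrom 1 1 v) * R u v))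
    ≡⟨ ΣW-ext (λ _ → n) 1 n (λ u → cong (ind (boundedFrom 0 1 u) *_)
         (trans (boundedFrom-alphabet 1 1 n (suc n) (R u) ≤-refl) (ΣW-bound-ext (λ i → +-comm i 1) 1 n (R u)))) ⟩
  ΣW (λ _ → n) 1 n (λ u → ind (boundedFrom 0 1 u) * ΣW bound-v 1 n (R u))
    ≡⟨ trans (boundedFrom-alphabet 0 1 n n _ ≤-refl) (ΣW-bound-ext (λ i → +-identityʳ i) 1 n _) ⟩
  ΣW bound-u 1 n (λ u → ΣW bound-v 1 n (R u)) ∎

letterOk : ℕ → ℕ → Bool
letterOk x a = (1 ≤ᵇ a) ∧ (a ≤ᵇ x)

wordOk : ℕ → List ℕ → Bool
wordOk x w = all (letterOk x) w ∧ nondecreasing w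

nondecreasing-tail : ∀ a l → nondecreasing (a ∷ l) ≡ true → nondecreasing l ≡ true
nondecreasing-tail a []      e = refl
nondecreasing-tail a (b ∷ l) e = proj₂ (∧-true⁻ (a ≤ᵇ b) _ e)

nondecreasing-head : ∀ a l → nondecreasing (a ∷ l) ≡ true → ∀ j → j < length (a ∷ l) → a ≤ at (a ∷ l) j
nondecreasing-head a l       e zero    _        = ≤-refl
nondecreasing-head a (b ∷ l) e (suc j) (s≤s j<) =
  ≤-trans (≤ᵇ-sound a b (proj₁ (∧-true⁻ (a ≤ᵇ b) _ e))) (nondecreasing-head b l (nondecreasing-tail a (b ∷ l) e) j j<)

nondecreasing-mono : ∀ w → nondecreasing w ≡ true → ∀ c j → c ≤ j → j < length w → at w c ≤ at w j
nondecreasing-mono (a ∷ l) e zero    j       _         j<       = nondecreasing-head a l e j j<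
nondecreasing-mono (a ∷ l) e (suc c) (suc j) (s≤s c≤j) (s≤s j<) = nondecreasing-mono l (nondecreasing-tail a l e) c j c≤j j<

wordOk-x-closed : ∀ x w → wordOk x w ≡ true → ∀ c j → c ≤ j → j < length w → at w c ≡ x → at w j ≡ x
wordOk-x-closed x w e c j c≤j j< refl with ∧-true⁻ (all (letterOk x) w) _ e
... | letters , nondec = ≤-antisym
  (≤ᵇ-sound _ x (proj₂ (∧-true⁻ (1 ≤ᵇ at w j) _ (all-drop⁻ (letterOk x) 0 w letters j z≤n j<))))
  (nondecreasing-mono w nondec c j c≤j j<)

letters-ok : ∀ x s n w → Fits (λ _ → x) s n w → all (letterOk x) w ≡ true
letters-ok x s zero    []          []         = refl
letters-ok x s (suc n) (suc a ∷ w) (a<x ∷ fw) rewrite <ᵇ-complete a x a<x = letters-ok x (suc s) n w fw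

wordOk-nondecFrom : ∀ x s n w → Fits (λ _ → x) s n w → wordOk x w ≡ nondecFrom 1 w
wordOk-nondecFrom x s zero    []          []         = refl
wordOk-nondecFrom x s (suc n) (suc a ∷ w) (a<x ∷ fw)
  rewrite <ᵇ-complete a x a<x | letters-ok x (suc s) n w fw = nondecreasing-cons (suc a) w

kernelCount-as-sum : ∀ x n → kernelCount x n ≡
  ΣW (λ _ → n) 1 n (λ u → ΣW (λ _ → suc n) 1 n (λ v → ΣW (λ _ → x) 1 n (λ w →
    ind (validPos x n (u , v , w)) * ind (isKernel x (u , v , w)))))
kernelCount-as-sum x n = begin
  length (filterᵇ (isKernel x) (positions x n))
    ≡⟨ length-filter (isKernel x) (positions x n) ⟩
  ΣL (positions x n) (λ p → ind (isKernel x p))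
    ≡⟨ ΣL-filter (validPos x n) L (λ p → ind (isKernel x p)) ⟩
  ΣL L F
    ≡⟨ ΣL-concatMap _ (words n n) F ⟩
  ΣL (words n n) (λ u → ΣL (concatMap (λ v → map (λ w → (u , v , w)) (words n x)) (words n (suc n))) F)
    ≡⟨ ΣL-cong (words n n) (λ u → trans (ΣL-concatMap _ (words n (suc n)) F)
                                        (ΣL-cong (words n (suc n)) (λ v → ΣL-map _ (words n x) F))) ⟩
  ΣL (words n n) (λ u → ΣL (words n (suc n)) (λ v → ΣL (words n x) (λ w → F (u , v , w))))
    ≡⟨ ΣL-words n n 1 _ ⟩
  ΣW (λ _ → n) 1 n (λ u → ΣL (words n (suc n)) (λ v → ΣL (words n x) (λ w → F (u , v , w))))
    ≡⟨ ΣW-ext (λ _ → n) 1 n (λ u → trans (ΣL-words n (suc n) 1 _)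
                                         (ΣW-ext (λ _ → suc n) 1 n (λ v → ΣL-words n x 1 _))) ⟩
  _ ∎
  where
  L : List Pos
  L = concatMap (λ u → concatMap (λ v → map (λ w → (u , v , w)) (words n x)) (words n (suc n))) (words n n)
  F : Pos → ℕ
  F p = ind (validPos x n p) * ind (isKernel x p)

kernel-summand : ∀ x n u v w → length u ≡ n → length v ≡ n → length w ≡ n →
  ind (validPos x n (u , v , w)) * ind (isKernel x (u , v , w)) ≡
  ind (boundedFrom 0 1 u) * (ind (boundedFrom 1 1 v) * (ind (wordOk x w) * ind (relKernel (drop (stem x w) u) (drop (stem x w) v))))
kernel-summand x n u v w lu lv lw = begin
  ind (validPos x n (u , v , w)) * ind (isKernel x (u , v , w))
    ≡⟨ cong (λ b → ind b * ind (isKernel x (u , v , w))) validity ⟩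
  ind (boundedFrom 0 1 u ∧ (boundedFrom 1 1 v ∧ wordOk x w)) * ind (isKernel x (u , v , w))
    ≡⟨ cong (_* ind (isKernel x (u , v , w)))
            (trans (ind-∧ (boundedFrom 0 1 u) _) (cong (ind (boundedFrom 0 1 u) *_) (ind-∧ (boundedFrom 1 1 v) _))) ⟩
  ind (boundedFrom 0 1 u) * (ind (boundedFrom 1 1 v) * ind (wordOk x w)) * ind (isKernel x (u , v , w))
    ≡⟨ rearrange (ind (boundedFrom 0 1 u)) (ind (boundedFrom 1 1 v)) (ind (wordOk x w)) _ ⟩
  ind (boundedFrom 0 1 u) * (ind (boundedFrom 1 1 v) * (ind (wordOk x w) * ind (isKernel x (u , v , w))))
    ≡⟨ cong (λ k → ind (boundedFrom 0 1 u) * (ind (boundedFrom 1 1 v) * k)) kernel ⟩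
  ind (boundedFrom 0 1 u) * (ind (boundedFrom 1 1 v) * (ind (wordOk x w) * ind (relKernel (drop (stem x w) u) (drop (stem x w) v)))) ∎
  where
  rearrange : ∀ a b c d → a * (b * c) * d ≡ a * (b * (c * d))
  rearrange = solve-∀
  validity : validPos x n (u , v , w) ≡ (boundedFrom 0 1 u ∧ (boundedFrom 1 1 v ∧ wordOk x w))
  validity rewrite ≡ᵇ-complete (length u) n lu | ≡ᵇ-complete (length v) n lv | ≡ᵇ-complete (length w) n lw = refl
  kernel : ind (wordOk x w) * ind (isKernel x (u , v , w)) ≡
           ind (wordOk x w) * ind (relKernel (drop (stem x w) u) (drop (stem x w) v))
  kernel with wordOk x w in ok
  ... | false = refl
  ... | true  = cong (λ b → 1 * ind b) (KernelPrefixes.kernel-char x n u v w lu lv lw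
                  (λ c j c≤j j<n → wordOk-x-closed x w ok c j c≤j (subst (j <_) (sym lw) j<n)))

factor-triple-sum : ∀ b₁ s₁ n₁ b₂ s₂ n₂ b₃ s₃ n₃ (A B C : List ℕ → ℕ)
                    (R : List ℕ → List ℕ → List ℕ → ℕ) →
  ΣW b₁ s₁ n₁ (λ u → ΣW b₂ s₂ n₂ (λ v → ΣW b₃ s₃ n₃ (λ w → A u * (B v * (C w * R u v w)))))
  ≡ ΣW b₃ s₃ n₃ (λ w → C w * ΣW b₁ s₁ n₁ (λ u → A u * ΣW b₂ s₂ n₂ (λ v → B v * R u v w)))
factor-triple-sum b₁ s₁ n₁ b₂ s₂ n₂ b₃ s₃ n₃ A B C R = begin
  ΣW b₁ s₁ n₁ (λ u → ΣW b₂ s₂ n₂ (λ v → ΣW b₃ s₃ n₃ (λ w → A u * (B v * (C w * R u v w)))))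
    ≡⟨ ΣW-ext b₁ s₁ n₁ (λ u → ΣW-swap b₂ s₂ n₂ b₃ s₃ n₃ _) ⟩
  ΣW b₁ s₁ n₁ (λ u → ΣW b₃ s₃ n₃ (λ w → ΣW b₂ s₂ n₂ (λ v → A u * (B v * (C w * R u v w)))))
    ≡⟨ ΣW-swap b₁ s₁ n₁ b₃ s₃ n₃ _ ⟩
  ΣW b₃ s₃ n₃ (λ w → ΣW b₁ s₁ n₁ (λ u → ΣW b₂ s₂ n₂ (λ v → A u * (B v * (C w * R u v w)))))
    ≡⟨ ΣW-ext b₃ s₃ n₃ (λ w → trans (ΣW-ext b₁ s₁ n₁ (λ u →
          trans (ΣW-ext b₂ s₂ n₂ (λ v → rearrange (A u) (B v) (C w) (R u v w)))
                (trans (ΣW-*ˡ b₂ s₂ n₂ (C w) _) (cong (C w *_) (ΣW-*ˡ b₂ s₂ n₂ (A u) _)))))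
       (ΣW-*ˡ b₁ s₁ n₁ (C w) _)) ⟩
  ΣW b₃ s₃ n₃ (λ w → C w * ΣW b₁ s₁ n₁ (λ u → A u * ΣW b₂ s₂ n₂ (λ v → B v * R u v w))) ∎
  where
  rearrange : ∀ a b c r → a * (b * (c * r)) ≡ c * (a * (b * r))
  rearrange = solve-∀

kernelCount-by-w : ∀ x n → kernelCount x n ≡ ΣW (λ _ → x) 1 n (λ w → ind (wordOk x w) * kernelsWithStem n (stem x w))
kernelCount-by-w x n = begin
  kernelCount x n
    ≡⟨ kernelCount-as-sum x n ⟩
  ΣW Bu 1 n (λ u → ΣW Bv 1 n (λ v → ΣW Bw 1 n (λ w → ind (validPos x n (u , v , w)) * ind (isKernel x (u , v , w)))))
    ≡⟨ ΣW-cong Bu 1 n (λ u fu → ΣW-cong Bv 1 n (λ v fv → ΣW-cong Bw 1 n (λ w fw →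
         kernel-summand x n u v w (Fits-length fu) (Fits-length fv) (Fits-length fw)))) ⟩
  ΣW Bu 1 n (λ u → ΣW Bv 1 n (λ v → ΣW Bw 1 n (λ w → Iu u * (Iv v * (Iw w * R u v w)))))
    ≡⟨ factor-triple-sum Bu 1 n Bv 1 n Bw 1 n Iu Iv Iw R ⟩
  ΣW Bw 1 n (λ w → Iw w * ΣW Bu 1 n (λ u → Iu u * ΣW Bv 1 n (λ v → Iv v * R u v w)))
    ≡⟨ ΣW-ext Bw 1 n (λ w → cong (ind (wordOk x w) *_) (uv-alphabets n (λ u v → R u v w))) ⟩
  ΣW Bw 1 n (λ w → ind (wordOk x w) * kernelsWithStem n (stem x w)) ∎
  where
  Bu Bv Bw : ℕ → ℕ
  Bu _ = n
  Bv _ = suc n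
  Bw _ = x
  Iu Iv Iw : List ℕ → ℕ
  Iu u = ind (boundedFrom 0 1 u)
  Iv v = ind (boundedFrom 1 1 v)
  Iw w = ind (wordOk x w)
  R : List ℕ → List ℕ → List ℕ → ℕ
  R u v w = ind (relKernel (drop (stem x w) u) (drop (stem x w) v))

sum-over-stems : ∀ x' n → ΣW (λ _ → suc x') 1 n (λ w → ind (wordOk (suc x') w) * kernelsWithStem n (stem (suc x') w))
                          ≡ Σ< (suc n) (λ m → kernelsWithStem n m * binomX (suc x') m)
sum-over-stems x' n = begin
  ΣW Bw 1 n (λ w → ind (wordOk x w) * kernelsWithStem n (stem x w))
    ≡⟨ ΣW-cong Bw 1 n (λ w fw → trans
         (cong₂ (λ b k → ind b * k) (wordOk-nondecFrom x 1 n w fw)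
                (sym (Σ<-delta (suc n) (stem x w) (kernelsWithStem n) (stem<n w fw))))
         (sym (Σ<-*ˡ (suc n) (ind (nondecFrom 1 w)) (λ m → ind (m ≡ᵇ stem x w) * kernelsWithStem n m)))) ⟩
  ΣW Bw 1 n (λ w → Σ< (suc n) (λ m → ind (nondecFrom 1 w) * (ind (m ≡ᵇ stem x w) * kernelsWithStem n m)))
    ≡⟨ ΣW-Σ< Bw 1 n (suc n) (λ m w → ind (nondecFrom 1 w) * (ind (m ≡ᵇ stem x w) * kernelsWithStem n m)) ⟩
  Σ< (suc n) (λ m → ΣW Bw 1 n (λ w → ind (nondecFrom 1 w) * (ind (m ≡ᵇ stem x w) * kernelsWithStem n m)))
    ≡⟨ Σ<-cong (suc n) (λ m m≤n → trans
         (ΣW-ext Bw 1 n (λ w → rearrange (ind (nondecFrom 1 w)) (ind (m ≡ᵇ stem x w)) (kernelsWithStem n m)))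
         (trans (ΣW-*ˡ Bw 1 n (kernelsWithStem n m) _)
                (cong (kernelsWithStem n m *_) (trans (ΣW-const-start x 1 0 n _) (stemCount-binomX n m (s≤s⁻¹ m≤n)))))) ⟩
  Σ< (suc n) (λ m → kernelsWithStem n m * binomX x m) ∎
  where
  open StemCount x'
  Bw : ℕ → ℕ
  Bw _ = x
  stem<n : ∀ w → Fits Bw 1 n w → stem x w < suc n
  stem<n w fw = s≤s (subst (stem x w ≤_) (Fits-length fw) (stem-length x w))
  rearrange : ∀ a b c → a * (b * c) ≡ c * (a * b)
  rearrange = solve-∀

kernelsWithStem-chains : ∀ n m → m < n →
  kernelsWithStem n m ≡ m ! * (suc m ! * sumBelow (n ∸ m) (λ k → chains k m n))
kernelsWithStem-chains n m m<n = begin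
  kernelsWithStem n m
    ≡⟨ cong (λ k → kernelsWithStem k m) (sym (m+[n∸m]≡n (<⇒≤ m<n))) ⟩
  kernelsWithStem (m + (n ∸ m)) m
    ≡⟨ kernelsWithStem-closed m (n ∸ m) ⟩
  m ! * (suc m ! * G m (n ∸ m))
    ≡⟨ cong (λ k → m ! * (suc m ! * k)) (G≡chainSum₁ (n ∸ m) (n ∸ m) m n ≤-refl (m+[n∸m]≡n (<⇒≤ m<n))) ⟩
  m ! * (suc m ! * chainSum₁ m n)
    ≡⟨ cong (λ b → m ! * (suc m ! * (if b then chainSum m n else 1))) (<ᵇ-complete m n m<n) ⟩
  m ! * (suc m ! * chainSum m n)
    ≡⟨ cong (λ k → m ! * (suc m ! * k)) (sym (sumBelow≡Σ< (n ∸ m) _)) ⟩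
  m ! * (suc m ! * sumBelow (n ∸ m) (λ k → chains k m n)) ∎

kernelsWithStem-full : ∀ n → kernelsWithStem n n ≡ n ! * suc n !
kernelsWithStem-full n = begin
  kernelsWithStem n n             ≡⟨ cong (λ k → kernelsWithStem k n) (sym (+-identityʳ n)) ⟩
  kernelsWithStem (n + 0) n       ≡⟨ kernelsWithStem-closed n 0 ⟩
  n ! * (suc n ! * 1)             ≡⟨ cong (n ! *_) (*-identityʳ (suc n !)) ⟩
  n ! * suc n !                   ∎

stem-sum≡kappaFormula : ∀ x n → Σ< (suc n) (λ m → kernelsWithStem n m * binomX x m) ≡ kappaFormula x n
stem-sum≡kappaFormula x n =
  trans (Σ<-last n _) (cong₂ _+_ (trans (Σ<-cong n below) (sym (sumBelow≡Σ< n _))) full)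
  where
  below : ∀ m → m < n → kernelsWithStem n m * binomX x m ≡
          binomX x m * m ! * suc m ! * sumBelow (n ∸ m) (λ k → chains k m n)
  below m m<n = trans (cong (_* binomX x m) (kernelsWithStem-chains n m m<n)) (rearrange (m !) (suc m !) _ (binomX x m))
    where
    rearrange : ∀ a b c d → a * (b * c) * d ≡ d * a * b * c
    rearrange = solve-∀
  full : kernelsWithStem n n * binomX x n ≡ binomX x n * n ! * suc n !
  full = trans (cong (_* binomX x n) (kernelsWithStem-full n)) (rearrange (n !) (suc n !) (binomX x n))
    where
    rearrange : ∀ a b c → a * b * c ≡ c * a * b
    rearrange = solve-∀

theorem5p2 : (x : ℕ) → 1 ≤ x → (n : ℕ) → kernelCount x n ≡ kappaFormula x n
theorem5p2 (suc x') _ n = begin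
  kernelCount (suc x') n
    ≡⟨ kernelCount-by-w (suc x') n ⟩
  ΣW (λ _ → suc x') 1 n (λ w → ind (wordOk (suc x') w) * kernelsWithStem n (stem (suc x') w))
    ≡⟨ sum-over-stems x' n ⟩
  Σ< (suc n) (λ m → kernelsWithStem n m * binomX (suc x') m)
    ≡⟨ stem-sum≡kappaFormula (suc x') n ⟩
  kappaFormula (suc x') n ∎
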